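{- Let $q\ge 2$ and $m\ge 1$ be integers. Let $N^{\rm coord}_q(m)$ be the smallest natural number $N$ such that for every $n>N$ there is no A-primitive partition of ${\bf Z}_q^n$ into $q^m$ subcubes of dimension $n-m$ (such an $N$ exists). Then $N^{\rm coord}_q(m)=\frac{q^m-1}{q-1}$, and the number of distinct unordered A-primitive partitions of ${\bf Z}_q^{h}$, $h=\frac{q^m-1}{q-1}$, into $q^m$ subcubes of dimension $h-m$ equals $h!=\left(\frac{q^m-1}{q-1}\right)!$.
   Context: For $0\le k\le n$, a $k$-dimensional subcube of ${\bf Z}_q^n$ is a subset obtained by fixing the values of some $n-k$ coordinates to given elements of ${\bf Z}_q$ and letting each of the remaining $k$ coordinates run over all of ${\bf Z}_q$. A partition into subcubes is a family of pairwise disjoint subcubes whose union is ${\bf Z}_q^n$; partitions are counted as unordered sets. A partition of ${\bf Z}_q^n$ into subcubes is called A-primitive (Agievich-primitive) if every coordinate $i\in\{1,\dots,n\}$ is fixed in at least one of the subcubes of the partition. -}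

module Defs where

open import Data.Nat using (ℕ; zero; suc; _+_; _^_; _∸_; _<_; _≤_)
open import Data.Nat.DivMod using (_/_)
open import Data.Fin using (Fin)
open import Data.Maybe using (Maybe; just; nothing)
open import Data.Vec using (Vec; []; _∷_; lookup)
open import Data.List using (List; length)
open import Data.List.Membership.Propositional using (_∈_)
open import Data.List.Relation.Unary.AllPairs using (AllPairs)
open import Data.List.Relation.Binary.Permutation.Propositional using (_↭_)
open import Data.Product using (Σ; ∃; _×_)
open import Data.Sum using (_⊎_)
open import Data.Empty using (⊥)
open import Relation.Binary.PropositionalEquality using (_≡_)

Point : ℕ → ℕ → Set
Point q n = Vec (Fin q) n

-- A subcube of Z_q^n: for each coordinate, either fixed to a value
-- (just a) or free (nothing).
Cube : ℕ → ℕ → Set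
Cube q n = Vec (Maybe (Fin q)) n

_∈C_ : ∀ {q n} → Point q n → Cube q n → Set
x ∈C c = ∀ i → (lookup c i ≡ nothing) ⊎ (lookup c i ≡ just (lookup x i))

dim : ∀ {q n} → Cube q n → ℕ
dim [] = zero
dim (nothing ∷ c) = suc (dim c)
dim (just _ ∷ c) = dim c

DisjointC : ∀ {q n} → Cube q n → Cube q n → Set
DisjointC c d = ∀ x → x ∈C c → x ∈C d → ⊥

IsPartition : ∀ {q n} → List (Cube q n) → Set
IsPartition {q} {n} P =
  AllPairs DisjointC P × (∀ (x : Point q n) → ∃ λ c → (c ∈ P) × (x ∈C c))

APrimitive : ∀ {q n} → List (Cube q n) → Set
APrimitive {q} {n} P = ∀ (i : Fin n) → ∃ λ c → (c ∈ P) × (∃ λ (a : Fin q) → lookup c i ≡ just a)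

-- P is an A-primitive partition of Z_q^n into q^m subcubes of dimension n - m
-- (dimension n - m is stated without truncated subtraction as dim c + m ≡ n)
APrimPartition : (q m n : ℕ) → List (Cube q n) → Set
APrimPartition q m n P =
  IsPartition P × APrimitive P × (length P ≡ q ^ m)
  × (∀ c → c ∈ P → dim c + m ≡ n)

-- h = (q^m - 1)/(q - 1); only meaningful for q ≥ 2 (defined as 0 otherwise)
hOf : ℕ → ℕ → ℕ
hOf zero m = zero
hOf (suc zero) m = zero
hOf (suc (suc r)) m = (suc (suc r) ^ m ∸ 1) / suc r

IsNcoord : (q m N : ℕ) → Set
IsNcoord q m N =
  (∀ n → N < n → ∀ (P : List (Cube q n)) → APrimPartition q m n P → ⊥)
  × (∀ N′ → (∀ n → N′ < n → ∀ (P : List (Cube q n)) → APrimPartition q m n P → ⊥) → N ≤ N′)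

-- Let P partition a subcube D and let L list distinct coordinates that are free in D but fixed in
-- some cube of P. Then (q - 1)|L| + 1 ≤ |P|: choose i ∈ L fixed in as few cubes as possible; the
-- traces of P on the slab x_i = 0 partition it and still fix the rest of L, while at least q - 1
-- cubes, one for each other value at i, miss that slab. An A-primitive partition of Z_q^n into q^m
-- cubes has L = all n coordinates, so (q - 1)n + 1 ≤ q^m, i.e. n ≤ h.
--
-- In the case of equality some coordinate is fixed in every cube; splitting along it leaves q
-- equality cases of depth m - 1 whose label sets are disjoint. Hence the partition is a q-ary
-- decision tree of depth m whose h nodes carry distinct coordinates. Listing the root and then the
-- labels of the q subtrees block by block identifies these trees with the orderings of the h
-- coordinates, so there are exactly h! of them.

module Submission where

open import Defs
open import Data.Nat using (ℕ; zero; suc; _+_; _*_; _^_; _∸_; _≤_; _<_; z≤n; s≤s; z<s; _!)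
open import Data.Nat.Properties hiding (_≟_)
open import Data.Nat.DivMod using (_/_; m*n/n≡m)
open import Data.Nat.Tactic.RingSolver using (solve-∀)
open import Data.Bool using (if_then_else_)
open import Data.Fin using (Fin; zero; suc; punchIn; punchOut; remQuot; combine; fromℕ<)
open import Data.Fin.Properties using (_≟_; punchInᵢ≢i; punchIn-injective; punchOut-punchIn; remQuot-combine; combine-remQuot)
import Data.Fin.Properties as Finₚ
open import Data.Maybe using (Maybe; just; nothing; fromMaybe)
open import Data.Maybe.Properties using (just-injective)
import Data.Maybe.Properties as Maybe
open import Data.Vec using (Vec; []; _∷_; lookup; tabulate; replicate; removeAt; _[_]≔_)
open import Data.Vec.Properties using (lookup∘tabulate; lookup∘update; lookup∘update′; lookup-replicate; removeAt-punchOut; []≔-lookup)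
import Data.Vec as Vec
import Data.Vec.Properties as Vec
open import Data.List using (List; []; _∷_; _++_; length; filter; map; take; drop; allFin)
open import Data.List.Properties
  using (length-++; length-++-sucʳ; length-map; length-take; length-drop; length-tabulate; take++drop≡id;
         filter-++; filter-all; filter-none; filter-reject; ++-identityʳ; ∷-injective; map-id-local)
open import Data.List.Extrema.Nat using (argmin; argmin-sel; f[argmin]≤f[xs])
open import Data.List.Membership.Propositional using (_∈_; find; lose)
open import Data.List.Membership.Propositional.Properties
  using (∈-∃++; ∈-++⁻; ∈-++⁺ˡ; ∈-++⁺ʳ; ∈-map⁻; ∈-map⁺; ∈-filter⁺; ∈-filter⁻; ∈-map∘filter⁻)
import Data.List.Membership.DecPropositional as DecMembership
open import Data.List.Relation.Unary.Any as Any using (here; there)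
open import Data.List.Relation.Unary.All as All using (All; all?)
open import Data.List.Relation.Unary.All.Properties using (¬All⇒Any¬)
open import Data.List.Relation.Unary.AllPairs as AllPairs using (AllPairs; []; _∷_)
import Data.List.Relation.Unary.AllPairs.Properties as AllPairs
open import Data.List.Relation.Unary.Unique.Propositional using (Unique)
import Data.List.Relation.Unary.Unique.Propositional.Properties as Unique
open import Data.List.Relation.Binary.Subset.Propositional using (_⊆_)
open import Data.List.Relation.Binary.Permutation.Propositional using (_↭_; ↭-refl; ↭-trans; ↭-sym; ↭-reflexive; prep)
open import Data.List.Relation.Binary.Permutation.Propositional.Properties using (shift; ++⁺; ++⁺ˡ; ↭-length; ∈-resp-↭; filter-↭)
open import Data.Product using (Σ; ∃; _×_; _,_; proj₁; proj₂; uncurry)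
open import Data.Sum using (_⊎_; inj₁; inj₂)
open import Data.Empty using (⊥; ⊥-elim)
open import Function using (_∘_; const)
open import Function.Definitions using (Injective)
open import Level using (0ℓ)
import Algebra.Properties.CommutativeSemigroup
open import Relation.Binary using (DecidableEquality)
open import Relation.Binary.PropositionalEquality
open import Relation.Nullary using (¬_; Dec; yes; no; does)
open import Relation.Nullary.Decidable using (decidable-stable; map′; ¬?; _→-dec_)
open import Relation.Unary using (Pred; Decidable)
open import Relation.Unary.Properties using (∁?)

-- Pigeonhole and counting in lists

∈-++∷⁻ : ∀ {A : Set} (xs : List A) {x y ys} → y ∈ xs ++ x ∷ ys → y ≡ x ⊎ y ∈ xs ++ ys
∈-++∷⁻ xs y∈ with ∈-++⁻ xs y∈
... | inj₁ y∈xs = inj₂ (∈-++⁺ˡ y∈xs)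
... | inj₂ (here y≡x) = inj₁ y≡x
... | inj₂ (there y∈ys) = inj₂ (∈-++⁺ʳ xs y∈ys)

length-allFin : ∀ n → length (allFin n) ≡ n
length-allFin n = length-tabulate (λ i → i)

module _ {A : Set} where

  unique∧⊆⇒length≤ : ∀ {xs ys : List A} → Unique xs → xs ⊆ ys → length xs ≤ length ys
  unique∧⊆⇒length≤ {[]} _ _ = z≤n
  unique∧⊆⇒length≤ {x ∷ xs} (x∉xs ∷ u) xs⊆ys with ∈-∃++ (xs⊆ys (here refl))
  ... | ys₁ , ys₂ , refl =
    ≤-trans (s≤s (unique∧⊆⇒length≤ u xs⊆ys₁++ys₂)) (≤-reflexive (sym (length-++-sucʳ ys₁ x ys₂)))
    where
    xs⊆ys₁++ys₂ : xs ⊆ ys₁ ++ ys₂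
    xs⊆ys₁++ys₂ {z} z∈xs with ∈-++∷⁻ ys₁ (xs⊆ys (there z∈xs))
    ... | inj₁ z≡x = ⊥-elim (All.lookup x∉xs z∈xs (sym z≡x))
    ... | inj₂ z∈ = z∈

  -- Removing y from ys still covers zs, since y′ takes the same value.
  unique∧⊆map⇒length< : ∀ {B : Set} (f : B → A) {zs : List A} {ys : List B} {y y′} →
    Unique zs → zs ⊆ map f ys → y ∈ ys → y′ ∈ ys → y′ ≢ y → f y ≡ f y′ → length zs < length ys
  unique∧⊆map⇒length< f {zs} {ys} {y} {y′} u zs⊆ y∈ y′∈ y′≢y fy≡fy′ with ∈-∃++ y∈
  ... | ys₁ , ys₂ , refl = begin
      suc (length zs)                 ≤⟨ s≤s (unique∧⊆⇒length≤ u zs⊆map) ⟩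
      suc (length (map f (ys₁ ++ ys₂))) ≡⟨ cong suc (length-map f (ys₁ ++ ys₂)) ⟩
      suc (length (ys₁ ++ ys₂))       ≡⟨ length-++-sucʳ ys₁ y ys₂ ⟨
      length (ys₁ ++ y ∷ ys₂)         ∎
    where
    open ≤-Reasoning
    remove-y : ∀ {w} → w ∈ ys₁ ++ y ∷ ys₂ → ∃ λ w′ → w′ ∈ ys₁ ++ ys₂ × f w ≡ f w′
    remove-y {w} w∈ with ∈-++∷⁻ ys₁ w∈
    ... | inj₂ w∈′ = w , w∈′ , refl
    ... | inj₁ refl with ∈-++∷⁻ ys₁ y′∈
    ...   | inj₁ y′≡y = ⊥-elim (y′≢y y′≡y)
    ...   | inj₂ y′∈′ = y′ , y′∈′ , fy≡fy′
    zs⊆map : zs ⊆ map f (ys₁ ++ ys₂)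
    zs⊆map z∈ with ∈-map⁻ f (zs⊆ z∈)
    ... | w , w∈ , refl with remove-y w∈
    ...   | w′ , w′∈ , fw≡fw′ = subst (_∈ map f (ys₁ ++ ys₂)) (sym fw≡fw′) (∈-map⁺ f w′∈)

  module _ {P Q : Pred A 0ℓ} (P? : Decidable P) (Q? : Decidable Q) where

    length-filter-mono : ∀ xs → (∀ {x} → x ∈ xs → P x → Q x) → length (filter P? xs) ≤ length (filter Q? xs)
    length-filter-mono [] _ = z≤n
    length-filter-mono (x ∷ xs) P⇒Q with P? x | Q? x | length-filter-mono xs (P⇒Q ∘ there)
    ... | yes px | no ¬qx | _  = ⊥-elim (¬qx (P⇒Q (here refl) px))
    ... | yes _  | yes _  | ih = s≤s ih
    ... | no _   | yes _  | ih = m≤n⇒m≤1+n ih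
    ... | no _   | no _   | ih = ih

    length-filter-< : ∀ xs → (∀ {x} → x ∈ xs → P x → Q x) →
                      ∀ {x} → x ∈ xs → Q x → ¬ P x → length (filter P? xs) < length (filter Q? xs)
    length-filter-< (y ∷ xs) P⇒Q (here refl) qx ¬px with P? y | Q? y
    ... | yes py | _      = ⊥-elim (¬px py)
    ... | no _   | no ¬qy = ⊥-elim (¬qy qx)
    ... | no _   | yes _  = s≤s (length-filter-mono xs (P⇒Q ∘ there))
    length-filter-< (y ∷ xs) P⇒Q (there x∈xs) qx ¬px
      with P? y | Q? y | length-filter-< xs (P⇒Q ∘ there) x∈xs qx ¬px
    ... | yes py | no ¬qy | _  = ⊥-elim (¬qy (P⇒Q (here refl) py))
    ... | yes _  | yes _  | ih = s≤s ih
    ... | no _   | yes _  | ih = m≤n⇒m≤1+n ih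
    ... | no _   | no _   | ih = ih

  length-filter+length-filter-∁ : ∀ {P : Pred A 0ℓ} (P? : Decidable P) xs →
    length (filter P? xs) + length (filter (∁? P?) xs) ≡ length xs
  length-filter+length-filter-∁ P? [] = refl
  length-filter+length-filter-∁ P? (x ∷ xs) with P? x
  ... | yes _ = cong suc (length-filter+length-filter-∁ P? xs)
  ... | no _ = trans (+-suc _ _) (cong suc (length-filter+length-filter-∁ P? xs))

AllPairs-map∘filter⁺ : ∀ {A B : Set} {P : Pred A 0ℓ} {R : A → A → Set} {S : B → B → Set}
  (f : A → B) (P? : Decidable P) → (∀ {x y} → P x → P y → R x y → S (f x) (f y)) →
  ∀ {xs} → AllPairs R xs → AllPairs S (map f (filter P? xs))
AllPairs-map∘filter⁺ f P? R⇒S [] = []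
AllPairs-map∘filter⁺ {S = S} f P? R⇒S {x ∷ xs} (Rx ∷ pairs) with P? x
... | no _ = AllPairs-map∘filter⁺ f P? R⇒S pairs
... | yes px = All.tabulate head-related ∷ AllPairs-map∘filter⁺ f P? R⇒S pairs
  where
  head-related : ∀ {y} → y ∈ map f (filter P? xs) → S (f x) y
  head-related y∈ with ∈-map∘filter⁻ f P? y∈
  ... | z , z∈ , refl , pz = R⇒S px pz (All.lookup Rx z∈)

module _ {A : Set} (_≟_ : DecidableEquality A) where

  delete : A → List A → List A
  delete x = filter (λ y → ¬? (y ≟ x))

  ∈-delete⁻ : ∀ {x y} xs → y ∈ delete x xs → y ∈ xs × y ≢ x
  ∈-delete⁻ {x} xs = ∈-filter⁻ (λ y → ¬? (y ≟ x))

  Unique-delete : ∀ {x xs} → Unique xs → Unique (delete x xs)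
  Unique-delete {x} = Unique.filter⁺ (λ y → ¬? (y ≟ x))

  length-delete : ∀ {x xs} → Unique xs → x ∈ xs → length xs ≡ suc (length (delete x xs))
  length-delete {x} {y ∷ xs} (y∉xs ∷ _) (here refl) with y ≟ y
  ... | no y≢y = ⊥-elim (y≢y refl)
  ... | yes _ = cong (suc ∘ length) (sym (filter-all (λ z → ¬? (z ≟ y)) (All.map (λ y≢z z≡y → y≢z (sym z≡y)) y∉xs)))
  length-delete {x} {y ∷ xs} (y∉xs ∷ u) (there x∈xs) with y ≟ x
  ... | yes refl = ⊥-elim (All.lookup y∉xs x∈xs refl)
  ... | no _ = cong suc (length-delete u x∈xs)

-- Sums and concatenations indexed by Fin k

m*[1+n]+1≡m*n+1+m : ∀ m n → m * suc n + 1 ≡ m * n + 1 + m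
m*[1+n]+1≡m*n+1+m = solve-∀

∑ : ∀ {k} → (Fin k → ℕ) → ℕ
∑ {zero} f = 0
∑ {suc k} f = f zero + ∑ (f ∘ suc)

∑-cong : ∀ {k} {f g : Fin k → ℕ} → (∀ a → f a ≡ g a) → ∑ f ≡ ∑ g
∑-cong {zero} _ = refl
∑-cong {suc k} f≗g = cong₂ _+_ (f≗g zero) (∑-cong (f≗g ∘ suc))

∑-distrib-+ : ∀ {k} (f g : Fin k → ℕ) → ∑ (λ a → f a + g a) ≡ ∑ f + ∑ g
∑-distrib-+ {zero} f g = refl
∑-distrib-+ {suc k} f g =
  trans (cong (f zero + g zero +_) (∑-distrib-+ (f ∘ suc) (g ∘ suc))) (+-interchange (f zero) (g zero) _ _)
  where open Algebra.Properties.CommutativeSemigroup +-commutativeSemigroup renaming (interchange to +-interchange)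

*-distribˡ-∑ : ∀ {k} c (f : Fin k → ℕ) → ∑ (λ a → c * f a) ≡ c * ∑ f
*-distribˡ-∑ {zero} c f = sym (*-zeroʳ c)
*-distribˡ-∑ {suc k} c f = trans (cong (c * f zero +_) (*-distribˡ-∑ c (f ∘ suc))) (sym (*-distribˡ-+ c (f zero) _))

∑-const : ∀ k c → ∑ {k} (λ _ → c) ≡ k * c
∑-const zero c = refl
∑-const (suc k) c = cong (c +_) (∑-const k c)

∑-mono-≤ : ∀ {k} {f g : Fin k → ℕ} → (∀ a → f a ≤ g a) → ∑ f ≤ ∑ g
∑-mono-≤ {zero} _ = z≤n
∑-mono-≤ {suc k} f≤g = +-mono-≤ (f≤g zero) (∑-mono-≤ (f≤g ∘ suc))

f≤∑f : ∀ {k} (f : Fin k → ℕ) a → f a ≤ ∑ f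
f≤∑f f zero = m≤m+n _ _
f≤∑f f (suc a) = ≤-trans (f≤∑f (f ∘ suc) a) (m≤n+m _ (f zero))

f+f≤∑f : ∀ {k} (f : Fin k → ℕ) {a b} → a ≢ b → f a + f b ≤ ∑ f
f+f≤∑f f {zero} {zero} a≢b = ⊥-elim (a≢b refl)
f+f≤∑f f {zero} {suc b} _ = +-monoʳ-≤ (f zero) (f≤∑f (f ∘ suc) b)
f+f≤∑f f {suc a} {zero} _ = ≤-trans (≤-reflexive (+-comm (f (suc a)) (f zero))) (+-monoʳ-≤ (f zero) (f≤∑f (f ∘ suc) a))
f+f≤∑f f {suc a} {suc b} a≢b = ≤-trans (f+f≤∑f (f ∘ suc) (a≢b ∘ cong suc)) (m≤n+m _ (f zero))

∑-mono-≤-tight : ∀ {k} {f g : Fin k → ℕ} → (∀ a → f a ≤ g a) → ∑ g ≤ ∑ f → ∀ a → f a ≡ g a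
∑-mono-≤-tight {suc k} {f} {g} f≤g ∑g≤∑f = go
  where
  head≡ : f zero ≡ g zero
  head≡ = ≤-antisym (f≤g zero) (+-cancelʳ-≤ _ _ _ (≤-trans (+-monoʳ-≤ (g zero) (∑-mono-≤ (f≤g ∘ suc))) ∑g≤∑f))
  go : ∀ a → f a ≡ g a
  go zero = head≡
  go (suc a) = ∑-mono-≤-tight (f≤g ∘ suc)
    (+-cancelˡ-≤ (f zero) _ _ (subst (λ z → z + ∑ (g ∘ suc) ≤ ∑ f) (sym head≡) ∑g≤∑f)) a

module _ {A : Set} {k : ℕ} {p : Fin k → Pred A 0ℓ} (p? : ∀ a → Decidable (p a)) where

  private
    hit : Fin k → A → ℕ
    hit a x = if does (p? a x) then 1 else 0

    ∑-length-filter-∷ : ∀ x xs →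
      ∑ (λ a → length (filter (p? a) (x ∷ xs))) ≡ ∑ (λ a → hit a x) + ∑ (λ a → length (filter (p? a) xs))
    ∑-length-filter-∷ x xs = trans (∑-cong step) (∑-distrib-+ (λ a → hit a x) _)
      where
      step : ∀ a → length (filter (p? a) (x ∷ xs)) ≡ hit a x + length (filter (p? a) xs)
      step a with p? a x
      ... | yes _ = refl
      ... | no _ = refl

    1≤hit : ∀ {a x} → p a x → 1 ≤ hit a x
    1≤hit {a} {x} pax with p? a x
    ... | yes _ = ≤-refl
    ... | no ¬pax = ⊥-elim (¬pax pax)

  length≤∑length-filter : ∀ xs → (∀ {x} → x ∈ xs → ∃ λ a → p a x) →
                          length xs ≤ ∑ (λ a → length (filter (p? a) xs))
  length≤∑length-filter [] _ = z≤n
  length≤∑length-filter (x ∷ xs) cover with cover (here refl)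
  ... | a , pax = ≤-trans (+-mono-≤ (≤-trans (1≤hit pax) (f≤∑f _ a)) (length≤∑length-filter xs (cover ∘ there)))
                          (≤-reflexive (sym (∑-length-filter-∷ x xs)))

  length<∑length-filter : ∀ xs → (∀ {x} → x ∈ xs → ∃ λ a → p a x) →
                          ∀ {x a b} → x ∈ xs → p a x → p b x → a ≢ b →
                          length xs < ∑ (λ a → length (filter (p? a) xs))
  length<∑length-filter (x ∷ xs) cover (here refl) pax pbx a≢b =
    ≤-trans (+-mono-≤ (≤-trans (+-mono-≤ (1≤hit pax) (1≤hit pbx)) (f+f≤∑f _ a≢b))
                      (length≤∑length-filter xs (cover ∘ there)))
            (≤-reflexive (sym (∑-length-filter-∷ x xs)))
  length<∑length-filter (y ∷ xs) cover (there x∈xs) pax pbx a≢b with cover (here refl)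
  ... | c , pcy = ≤-trans (+-mono-≤ (≤-trans (1≤hit pcy) (f≤∑f _ c))
                                    (length<∑length-filter xs (cover ∘ there) x∈xs pax pbx a≢b))
                          (≤-reflexive (sym (∑-length-filter-∷ y xs)))

module _ {A : Set} where

  ⋃ : ∀ {k} → (Fin k → List A) → List A
  ⋃ {zero} g = []
  ⋃ {suc k} g = g zero ++ ⋃ (g ∘ suc)

  ∈-⋃⁺ : ∀ {k} (g : Fin k → List A) a {x} → x ∈ g a → x ∈ ⋃ g
  ∈-⋃⁺ g zero x∈ = ∈-++⁺ˡ x∈
  ∈-⋃⁺ g (suc a) x∈ = ∈-++⁺ʳ (g zero) (∈-⋃⁺ (g ∘ suc) a x∈)

  ∈-⋃⁻ : ∀ {k} (g : Fin k → List A) {x} → x ∈ ⋃ g → ∃ λ a → x ∈ g a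
  ∈-⋃⁻ {suc k} g x∈ with ∈-++⁻ (g zero) x∈
  ... | inj₁ x∈g₀ = zero , x∈g₀
  ... | inj₂ x∈rest with ∈-⋃⁻ (g ∘ suc) x∈rest
  ...   | a , x∈gₐ = suc a , x∈gₐ

  length-⋃ : ∀ {k} (g : Fin k → List A) → length (⋃ g) ≡ ∑ (length ∘ g)
  length-⋃ {zero} g = refl
  length-⋃ {suc k} g = trans (length-++ (g zero)) (cong (length (g zero) +_) (length-⋃ (g ∘ suc)))

  ⋃-cong : ∀ {k} {g h : Fin k → List A} → (∀ a → g a ≡ h a) → ⋃ g ≡ ⋃ h
  ⋃-cong {zero} _ = refl
  ⋃-cong {suc k} g≗h = cong₂ _++_ (g≗h zero) (⋃-cong (g≗h ∘ suc))

  ⋃-↭ : ∀ {k} {g h : Fin k → List A} → (∀ a → g a ↭ h a) → ⋃ g ↭ ⋃ h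
  ⋃-↭ {zero} _ = ↭-refl
  ⋃-↭ {suc k} g↭h = ++⁺ (g↭h zero) (⋃-↭ (g↭h ∘ suc))

  ⋃-[] : ∀ {k} (g : Fin k → List A) → (∀ a → g a ≡ []) → ⋃ g ≡ []
  ⋃-[] {zero} g _ = refl
  ⋃-[] {suc k} g g≡[] = trans (cong (_++ ⋃ (g ∘ suc)) (g≡[] zero)) (⋃-[] (g ∘ suc) (g≡[] ∘ suc))

  ⋃-single : ∀ {k} (g : Fin k → List A) b → (∀ a → a ≢ b → g a ≡ []) → ⋃ g ≡ g b
  ⋃-single g zero g≡[] = trans (cong (g zero ++_) (⋃-[] (g ∘ suc) (λ a → g≡[] (suc a) λ ())))
                               (++-identityʳ (g zero))
  ⋃-single g (suc b) g≡[] = trans (cong (_++ ⋃ (g ∘ suc)) (g≡[] zero λ ()))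
                                  (⋃-single (g ∘ suc) b (λ a a≢b → g≡[] (suc a) (a≢b ∘ Finₚ.suc-injective)))

  filter-⋃ : ∀ {k} {P : Pred A 0ℓ} (P? : Decidable P) (g : Fin k → List A) → filter P? (⋃ g) ≡ ⋃ (filter P? ∘ g)
  filter-⋃ {zero} P? g = refl
  filter-⋃ {suc k} P? g = trans (filter-++ P? (g zero) _) (cong (filter P? (g zero) ++_) (filter-⋃ P? (g ∘ suc)))

  AllPairs-⋃ : ∀ {k} {R : A → A → Set} (g : Fin k → List A) → (∀ a → AllPairs R (g a)) →
               (∀ {a b x y} → a ≢ b → x ∈ g a → y ∈ g b → R x y) → AllPairs R (⋃ g)
  AllPairs-⋃ {zero} g _ _ = []
  AllPairs-⋃ {suc k} g pairs across =
    AllPairs.++⁺ (pairs zero) (AllPairs-⋃ (g ∘ suc) (pairs ∘ suc) (λ a≢b → across (a≢b ∘ Finₚ.suc-injective)))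
      (All.tabulate λ x∈ → All.tabulate λ y∈ → let b , y∈′ = ∈-⋃⁻ (g ∘ suc) y∈ in across (λ ()) x∈ y∈′)

  Unique-⋃ : ∀ {k} (g : Fin k → List A) → (∀ a → Unique (g a)) →
             (∀ {a b x} → a ≢ b → x ∈ g a → x ∈ g b → ⊥) → Unique (⋃ g)
  Unique-⋃ g uniq disjoint = AllPairs-⋃ g uniq (λ a≢b x∈ y∈ x≡y → disjoint a≢b x∈ (subst (_∈ _) (sym x≡y) y∈))

  ↭-⋃-filter : ∀ {k} {p : Fin k → Pred A 0ℓ} (p? : ∀ a → Decidable (p a)) xs →
               (∀ {x} → x ∈ xs → ∃ λ b → p b x × (∀ a → p a x → a ≡ b)) →
               xs ↭ ⋃ (λ a → filter (p? a) xs)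
  ↭-⋃-filter p? [] _ = ↭-sym (↭-reflexive (⋃-[] (λ a → filter (p? a) []) (λ _ → refl)))
  ↭-⋃-filter p? (x ∷ xs) unique-index with unique-index (here refl)
  ... | b , pbx , only-b = ↭-sym (↭-trans (insert p? b pbx only-b) (prep x (↭-sym (↭-⋃-filter p? xs (unique-index ∘ there)))))
    where
    insert : ∀ {k} {p : Fin k → Pred A 0ℓ} (p? : ∀ a → Decidable (p a)) b → p b x → (∀ a → p a x → a ≡ b) →
             ⋃ (λ a → filter (p? a) (x ∷ xs)) ↭ x ∷ ⋃ (λ a → filter (p? a) xs)
    insert p? zero pbx only-b with p? zero x
    ... | no ¬pbx = ⊥-elim (¬pbx pbx)
    ... | yes _ = prep x (++⁺ˡ _ (↭-reflexive (⋃-cong λ a →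
                    filter-reject (p? (suc a)) (Finₚ.0≢1+n ∘ sym ∘ only-b (suc a)))))
    insert p? (suc b) pbx only-b with p? zero x
    ... | yes p₀x = ⊥-elim (Finₚ.0≢1+n (only-b zero p₀x))
    ... | no _ = ↭-trans (++⁺ˡ (filter (p? zero) xs) (insert (p? ∘ suc) b pbx (λ a pax → Finₚ.suc-injective (only-b (suc a) pax))))
                         (shift x (filter (p? zero) xs) _)

  chunk : (k s : ℕ) → List A → Fin k → List A
  chunk (suc k) s xs zero = take s xs
  chunk (suc k) s xs (suc a) = chunk k s (drop s xs) a

  private
    length-drop-* : ∀ k s (xs : List A) → length xs ≡ suc k * s → length (drop s xs) ≡ k * s
    length-drop-* k s xs len = trans (length-drop s xs) (trans (cong (_∸ s) len) (m+n∸m≡n s (k * s)))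

    Unique-++⇒disjoint : ∀ (xs : List A) {ys x} → Unique (xs ++ ys) → x ∈ xs → x ∈ ys → ⊥
    Unique-++⇒disjoint (x ∷ xs) (x∉ ∷ _) (here refl) x∈ys = All.lookup x∉ (∈-++⁺ʳ xs x∈ys) refl
    Unique-++⇒disjoint (_ ∷ xs) (_ ∷ u) (there x∈xs) x∈ys = Unique-++⇒disjoint xs u x∈xs x∈ys

  ⋃-chunk : ∀ k s (xs : List A) → length xs ≡ k * s → ⋃ (chunk k s xs) ≡ xs
  ⋃-chunk zero s [] _ = refl
  ⋃-chunk (suc k) s xs len =
    trans (cong (take s xs ++_) (⋃-chunk k s (drop s xs) (length-drop-* k s xs len))) (take++drop≡id s xs)

  chunk-⋃ : ∀ k s (g : Fin k → List A) → (∀ a → length (g a) ≡ s) → ∀ a → chunk k s (⋃ g) a ≡ g a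
  chunk-⋃ (suc k) s g len zero = take-++ (g zero) (len zero)
    where
    take-++ : ∀ (xs : List A) {ys s} → length xs ≡ s → take s (xs ++ ys) ≡ xs
    take-++ [] refl = refl
    take-++ (x ∷ xs) refl = cong (x ∷_) (take-++ xs refl)
  chunk-⋃ (suc k) s g len (suc a) =
    trans (cong (λ xs → chunk k s xs a) (drop-++ (g zero) (len zero))) (chunk-⋃ k s (g ∘ suc) (len ∘ suc) a)
    where
    drop-++ : ∀ (xs : List A) {ys s} → length xs ≡ s → drop s (xs ++ ys) ≡ ys
    drop-++ [] refl = refl
    drop-++ (x ∷ xs) refl = drop-++ xs refl

  length-chunk : ∀ k s (xs : List A) → length xs ≡ k * s → ∀ a → length (chunk k s xs a) ≡ s
  length-chunk (suc k) s xs len zero = trans (length-take s xs) (m≤n⇒m⊓n≡m (≤-trans (m≤m+n s (k * s)) (≤-reflexive (sym len))))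
  length-chunk (suc k) s xs len (suc a) = length-chunk k s (drop s xs) (length-drop-* k s xs len) a

  chunk-⊆ : ∀ k s (xs : List A) a → chunk k s xs a ⊆ xs
  chunk-⊆ (suc k) s xs zero x∈ = subst (_ ∈_) (take++drop≡id s xs) (∈-++⁺ˡ x∈)
  chunk-⊆ (suc k) s xs (suc a) x∈ = subst (_ ∈_) (take++drop≡id s xs) (∈-++⁺ʳ (take s xs) (chunk-⊆ k s (drop s xs) a x∈))

  ∈-chunk : ∀ k s (xs : List A) → length xs ≡ k * s → ∀ {x} → x ∈ xs → ∃ λ a → x ∈ chunk k s xs a
  ∈-chunk k s xs len x∈ = ∈-⋃⁻ (chunk k s xs) (subst (_ ∈_) (sym (⋃-chunk k s xs len)) x∈)

  Unique-chunk : ∀ k s {xs : List A} → Unique xs → ∀ a → Unique (chunk k s xs a)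
  Unique-chunk (suc k) s u zero = Unique.take⁺ s u
  Unique-chunk (suc k) s u (suc a) = Unique-chunk k s (Unique.drop⁺ s u) a

  chunk-disjoint : ∀ k s {xs : List A} → Unique xs → ∀ {a b x} → a ≢ b → x ∈ chunk k s xs a → x ∈ chunk k s xs b → ⊥
  chunk-disjoint (suc k) s u {zero} {zero} a≢b _ _ = a≢b refl
  chunk-disjoint (suc k) s {xs} u {zero} {suc b} _ x∈a x∈b =
    Unique-++⇒disjoint (take s xs) (subst Unique (sym (take++drop≡id s xs)) u) x∈a (chunk-⊆ k s (drop s xs) b x∈b)
  chunk-disjoint (suc k) s {xs} u {suc a} {zero} _ x∈a x∈b =
    Unique-++⇒disjoint (take s xs) (subst Unique (sym (take++drop≡id s xs)) u) x∈b (chunk-⊆ k s (drop s xs) a x∈a)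
  chunk-disjoint (suc k) s u {suc a} {suc b} a≢b x∈a x∈b =
    chunk-disjoint k s (Unique.drop⁺ s u) (a≢b ∘ cong suc) x∈a x∈b

-- Repetition-free lists indexed by Fin (n !)

module _ {A : Set} where

  -- Index k ∈ Fin (n !) is read in the mixed radix n, n-1, …, 1: its leading digit picks the first entry.
  -- Properties are proved for arrange, which receives the digit pair, as remQuot is stuck on a variable k.
  arrangement : ∀ {n} → Fin (n !) → Vec A n → List A
  arrange : ∀ {n} → Fin (suc n) × Fin (n !) → Vec A (suc n) → List A
  arrangement {zero} _ [] = []
  arrangement {suc n} k xs = arrange (remQuot (n !) k) xs
  arrange (j , k) xs = lookup xs j ∷ arrangement k (removeAt xs j)

  lookup-removeAt : ∀ {n} (xs : Vec A (suc n)) i t → lookup (removeAt xs i) t ≡ lookup xs (punchIn i t)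
  lookup-removeAt xs i t = trans (cong (lookup (removeAt xs i)) (sym (punchOut-punchIn i))) (removeAt-punchOut xs (punchInᵢ≢i i t ∘ sym))

  removeAt-injective : ∀ {n} (xs : Vec A (suc n)) i → Injective _≡_ _≡_ (lookup xs) → Injective _≡_ _≡_ (lookup (removeAt xs i))
  removeAt-injective xs i inj {s} {t} eq =
    punchIn-injective i s t (inj (trans (sym (lookup-removeAt xs i s)) (trans eq (lookup-removeAt xs i t))))

  length-arrangement : ∀ {n} (k : Fin (n !)) (xs : Vec A n) → length (arrangement k xs) ≡ n
  length-arrange : ∀ {n} p (xs : Vec A (suc n)) → length (arrange p xs) ≡ suc n
  length-arrangement {zero} _ [] = refl
  length-arrangement {suc n} k xs = length-arrange (remQuot (n !) k) xs
  length-arrange (j , k) xs = cong suc (length-arrangement k (removeAt xs j))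

  ∈-arrangement⁻ : ∀ {n} (k : Fin (n !)) (xs : Vec A n) {x} → x ∈ arrangement k xs → ∃ λ i → lookup xs i ≡ x
  ∈-arrange⁻ : ∀ {n} p (xs : Vec A (suc n)) {x} → x ∈ arrange p xs → ∃ λ i → lookup xs i ≡ x
  ∈-arrangement⁻ {zero} _ [] ()
  ∈-arrangement⁻ {suc n} k xs = ∈-arrange⁻ (remQuot (n !) k) xs
  ∈-arrange⁻ (j , k) xs (here refl) = j , refl
  ∈-arrange⁻ (j , k) xs (there x∈) with ∈-arrangement⁻ k (removeAt xs j) x∈
  ... | t , refl = punchIn j t , sym (lookup-removeAt xs j t)

  ∈-arrangement⁺ : ∀ {n} (k : Fin (n !)) (xs : Vec A n) i → lookup xs i ∈ arrangement k xs
  ∈-arrange⁺ : ∀ {n} p (xs : Vec A (suc n)) i → lookup xs i ∈ arrange p xs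
  ∈-arrangement⁺ {zero} _ [] ()
  ∈-arrangement⁺ {suc n} k xs = ∈-arrange⁺ (remQuot (n !) k) xs
  ∈-arrange⁺ (j , k) xs i with j ≟ i
  ... | yes refl = here refl
  ... | no j≢i = there (subst (_∈ _) (removeAt-punchOut xs j≢i) (∈-arrangement⁺ k (removeAt xs j) (punchOut j≢i)))

  Unique-arrangement : ∀ {n} (k : Fin (n !)) (xs : Vec A n) → Injective _≡_ _≡_ (lookup xs) → Unique (arrangement k xs)
  Unique-arrange : ∀ {n} p (xs : Vec A (suc n)) → Injective _≡_ _≡_ (lookup xs) → Unique (arrange p xs)
  Unique-arrangement {zero} _ [] _ = []
  Unique-arrangement {suc n} k xs = Unique-arrange (remQuot (n !) k) xs
  Unique-arrange (j , k) xs inj = All.tabulate head-fresh ∷ Unique-arrangement k (removeAt xs j) (removeAt-injective xs j inj)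
    where
    head-fresh : ∀ {y} → y ∈ arrangement k (removeAt xs j) → lookup xs j ≢ y
    head-fresh y∈ xⱼ≡y with ∈-arrangement⁻ k (removeAt xs j) y∈
    ... | t , refl = punchInᵢ≢i j t (sym (inj (trans xⱼ≡y (lookup-removeAt xs j t))))

  arrangement-injective : ∀ {n} (xs : Vec A n) → Injective _≡_ _≡_ (lookup xs) →
                          ∀ k k′ → arrangement k xs ≡ arrangement k′ xs → k ≡ k′
  arrange-injective : ∀ {n} (xs : Vec A (suc n)) → Injective _≡_ _≡_ (lookup xs) →
                      ∀ p p′ → arrange p xs ≡ arrange p′ xs → p ≡ p′
  arrangement-injective {zero} [] _ zero zero _ = refl
  arrangement-injective {suc n} xs inj k k′ eq = begin
    k                                       ≡⟨ combine-remQuot (n !) k ⟨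
    uncurry combine (remQuot (n !) k)       ≡⟨ cong (uncurry combine) (arrange-injective xs inj _ _ eq) ⟩
    uncurry combine (remQuot (n !) k′)      ≡⟨ combine-remQuot (n !) k′ ⟩
    k′                                      ∎
    where open ≡-Reasoning
  arrange-injective xs inj (j , k) (j′ , k′) eq with ∷-injective eq
  ... | xⱼ≡xⱼ′ , rest≡ with inj xⱼ≡xⱼ′
  ...   | refl = cong (j ,_) (arrangement-injective (removeAt xs j) (removeAt-injective xs j inj) k k′ rest≡)

  arrangement-surjective : ∀ {n} (xs : Vec A n) (ys : List A) → Unique ys → length ys ≡ n →
                           (∀ {y} → y ∈ ys → ∃ λ i → lookup xs i ≡ y) → ∃ λ k → arrangement k xs ≡ ys
  arrangement-surjective {zero} [] [] _ _ _ = zero , refl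
  arrangement-surjective {suc n} xs (y ∷ ys) (y∉ys ∷ u) len ys⊆xs with ys⊆xs (here refl)
  ... | j , refl with arrangement-surjective (removeAt xs j) ys u (suc-injective len) ys⊆rest
    where
    ys⊆rest : ∀ {y′} → y′ ∈ ys → ∃ λ t → lookup (removeAt xs j) t ≡ y′
    ys⊆rest y′∈ with ys⊆xs (there y′∈)
    ... | i , refl = punchOut j≢i , removeAt-punchOut xs j≢i
      where
      j≢i : j ≢ i
      j≢i refl = All.lookup y∉ys y′∈ refl
  ... | k , refl = combine j k , cong (λ p → arrange p xs) (remQuot-combine j k)

-- Subcubes and their partitions

infix 4 _⊑_

record _⊑_ {q n} (c D : Cube q n) : Set where
  constructor inside-at
  field
    _at_ : ∀ i → lookup D i ≡ nothing ⊎ lookup D i ≡ lookup c i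

open _⊑_ public

free-or-≡-trans : ∀ {A : Set} {m m′ m″ : Maybe A} →
                  m ≡ nothing ⊎ m ≡ m′ → m′ ≡ nothing ⊎ m′ ≡ m″ → m ≡ nothing ⊎ m ≡ m″
free-or-≡-trans (inj₁ free) _ = inj₁ free
free-or-≡-trans (inj₂ eq) (inj₁ free) = inj₁ (trans eq free)
free-or-≡-trans (inj₂ eq) (inj₂ eq′) = inj₂ (trans eq eq′)

⊑-refl : ∀ {q n} {c : Cube q n} → c ⊑ c
⊑-refl = inside-at λ i → inj₂ refl

⊑-trans : ∀ {q n} {c d D : Cube q n} → c ⊑ d → d ⊑ D → c ⊑ D
⊑-trans c⊑d d⊑D = inside-at λ i → free-or-≡-trans (d⊑D at i) (c⊑d at i)

⊑-tail : ∀ {q n} {x y} {c D : Cube q n} → (x ∷ c) ⊑ (y ∷ D) → c ⊑ D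
⊑-tail x∷c⊑y∷D = inside-at λ i → x∷c⊑y∷D at suc i

dim-⊑ : ∀ {q n} {c D : Cube q n} → c ⊑ D → dim c ≤ dim D
dim-⊑ {c = []} {[]} _ = z≤n
dim-⊑ {c = x ∷ c} {y ∷ D} c⊑D with c⊑D at zero | dim-⊑ (⊑-tail c⊑D)
dim-⊑ {c = nothing ∷ c} {.nothing ∷ D} _ | inj₁ refl | le = s≤s le
dim-⊑ {c = just _ ∷ c} {.nothing ∷ D} _ | inj₁ refl | le = m≤n⇒m≤1+n le
dim-⊑ {c = nothing ∷ c} {.nothing ∷ D} _ | inj₂ refl | le = s≤s le
dim-⊑ {c = just _ ∷ c} {.(just _) ∷ D} _ | inj₂ refl | le = le

dim-⊑-< : ∀ {q n} {c D : Cube q n} → c ⊑ D → dim c < dim D →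
          ∃ λ j → lookup D j ≡ nothing × ∃ λ a → lookup c j ≡ just a
dim-⊑-< {c = x ∷ c} {y ∷ D} c⊑D lt with c⊑D at zero
dim-⊑-< {c = just a ∷ c} {.nothing ∷ D} _ _ | inj₁ refl = zero , refl , a , refl
dim-⊑-< {c = nothing ∷ c} {.nothing ∷ D} c⊑D lt | inj₁ refl with dim-⊑-< (⊑-tail c⊑D) (≤-pred lt)
... | j , Dⱼ-free , cⱼ-fixed = suc j , Dⱼ-free , cⱼ-fixed
dim-⊑-< {c = nothing ∷ c} {.nothing ∷ D} c⊑D lt | inj₂ refl with dim-⊑-< (⊑-tail c⊑D) (≤-pred lt)
... | j , Dⱼ-free , cⱼ-fixed = suc j , Dⱼ-free , cⱼ-fixed
dim-⊑-< {c = just a ∷ c} {.(just a) ∷ D} c⊑D lt | inj₂ refl with dim-⊑-< (⊑-tail c⊑D) lt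
... | j , Dⱼ-free , cⱼ-fixed = suc j , Dⱼ-free , cⱼ-fixed

dim-⊑-≡ : ∀ {q n} {c D : Cube q n} → c ⊑ D → dim c ≡ dim D → c ≡ D
dim-⊑-≡ {c = []} {[]} _ _ = refl
dim-⊑-≡ {c = x ∷ c} {y ∷ D} c⊑D eq with c⊑D at zero
dim-⊑-≡ {c = nothing ∷ c} {.nothing ∷ D} c⊑D eq | inj₁ refl = cong (nothing ∷_) (dim-⊑-≡ (⊑-tail c⊑D) (suc-injective eq))
dim-⊑-≡ {c = just a ∷ c} {.nothing ∷ D} c⊑D eq | inj₁ refl = ⊥-elim (<-irrefl eq (s≤s (dim-⊑ (⊑-tail c⊑D))))
dim-⊑-≡ {c = nothing ∷ c} {.nothing ∷ D} c⊑D eq | inj₂ refl = cong (nothing ∷_) (dim-⊑-≡ (⊑-tail c⊑D) (suc-injective eq))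
dim-⊑-≡ {c = just a ∷ c} {.(just a) ∷ D} c⊑D eq | inj₂ refl = cong (just a ∷_) (dim-⊑-≡ (⊑-tail c⊑D) eq)

dim-fix : ∀ {q n} (D : Cube q n) i a → lookup D i ≡ nothing → suc (dim (D [ i ]≔ just a)) ≡ dim D
dim-fix (nothing ∷ D) zero a _ = refl
dim-fix (nothing ∷ D) (suc i) a D-free = cong suc (dim-fix D i a D-free)
dim-fix (just _ ∷ D) (suc i) a D-free = dim-fix D i a D-free

module Subcubes (r n : ℕ) where

  q : ℕ
  q = suc (suc r)

  C : Set
  C = Cube q n

  Free : C → Fin n → Set
  Free c i = lookup c i ≡ nothing

  Fixed : C → Fin n → Set
  Fixed c i = ∃ λ a → lookup c i ≡ just a

  fixed? : ∀ c i → Dec (Fixed c i)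
  fixed? c i with lookup c i
  ... | nothing = no λ ()
  ... | just a = yes (a , refl)

  free⇒¬fixed : ∀ {c i} → Free c i → ¬ Fixed c i
  free⇒¬fixed c≡nothing (a , c≡just) with trans (sym c≡nothing) c≡just
  ... | ()

  ¬fixed⇒free : ∀ {c i} → ¬ Fixed c i → Free c i
  ¬fixed⇒free {c} {i} ¬fixed with lookup c i
  ... | nothing = refl
  ... | just a = ⊥-elim (¬fixed (a , refl))

  Compatible : Maybe (Fin q) → Fin q → Set
  Compatible m a = m ≡ nothing ⊎ m ≡ just a

  compatible? : ∀ m a → Dec (Compatible m a)
  compatible? nothing a = yes (inj₁ refl)
  compatible? (just b) a with b ≟ a
  ... | yes refl = yes (inj₂ refl)
  ... | no b≢a = no λ { (inj₁ ()) ; (inj₂ refl) → b≢a refl }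

  fixed∧compatible⇒≡ : ∀ {m a b} → m ≡ just b → Compatible m a → b ≡ a
  fixed∧compatible⇒≡ refl (inj₂ refl) = refl

  ∈C-⊑ : ∀ {x : Point q n} {c D : C} → c ⊑ D → x ∈C c → x ∈C D
  ∈C-⊑ c⊑D x∈c i = free-or-≡-trans (c⊑D at i) (x∈c i)

  infixl 30 _[_≔_]

  _[_≔_] : C → Fin n → Fin q → C
  c [ i ≔ a ] = c [ i ]≔ just a

  lookup-fix : ∀ c i a → lookup (c [ i ≔ a ]) i ≡ just a
  lookup-fix c i a = lookup∘update i c (just a)

  lookup-fix′ : ∀ c {i j} a → j ≢ i → lookup (c [ i ≔ a ]) j ≡ lookup c j
  lookup-fix′ c a j≢i = lookup∘update′ j≢i c (just a)

  fix-fixed : ∀ {c i a} → lookup c i ≡ just a → c [ i ≔ a ] ≡ c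
  fix-fixed {c} {i} cᵢ≡a = subst (λ v → c [ i ]≔ v ≡ c) cᵢ≡a ([]≔-lookup c i)

  fix-⊑ : ∀ {D i} a → Free D i → D [ i ≔ a ] ⊑ D
  fix-⊑ {D} {i} a D-free = inside-at at′
    where
    at′ : ∀ j → Free D j ⊎ lookup D j ≡ lookup (D [ i ≔ a ]) j
    at′ j with j ≟ i
    ... | yes refl = inj₁ D-free
    ... | no j≢i = inj₂ (sym (lookup-fix′ D a j≢i))

  fix-mono : ∀ {c D} i a → c ⊑ D → c [ i ≔ a ] ⊑ D [ i ≔ a ]
  fix-mono {c} {D} i a c⊑D = inside-at at′
    where
    at′ : ∀ j → Free (D [ i ≔ a ]) j ⊎ lookup (D [ i ≔ a ]) j ≡ lookup (c [ i ≔ a ]) j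
    at′ j with j ≟ i
    ... | yes refl = inj₂ (trans (lookup-fix D i a) (sym (lookup-fix c i a)))
    ... | no j≢i with c⊑D at j
    ...   | inj₁ D-free = inj₁ (trans (lookup-fix′ D a j≢i) D-free)
    ...   | inj₂ D≡c = inj₂ (trans (lookup-fix′ D a j≢i) (trans D≡c (sym (lookup-fix′ c a j≢i))))

  ⊑-fix⇒≡ : ∀ {c D} i a → c ⊑ D [ i ≔ a ] → lookup c i ≡ just a
  ⊑-fix⇒≡ {c} {D} i a c⊑ with c⊑ at i
  ... | inj₁ D-free with trans (sym (lookup-fix D i a)) D-free
  ...   | ()
  ⊑-fix⇒≡ {c} {D} i a c⊑ | inj₂ D≡c = trans (sym D≡c) (lookup-fix D i a)

  corner : C → Point q n
  corner c = tabulate λ i → fromMaybe zero (lookup c i)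

  corner∈ : ∀ c → corner c ∈C c
  corner∈ c i rewrite lookup∘tabulate (λ i → fromMaybe zero (lookup c i)) i with lookup c i
  ... | nothing = inj₁ refl
  ... | just a = inj₂ refl

  ∈C-fixed : ∀ {x : Point q n} {c i a} → x ∈C c → lookup c i ≡ just a → lookup x i ≡ a
  ∈C-fixed {i = i} x∈c c≡a with x∈c i
  ... | inj₁ c-free with trans (sym c≡a) c-free
  ...   | ()
  ∈C-fixed {i = i} x∈c c≡a | inj₂ c≡x = just-injective (trans (sym c≡x) c≡a)

  ∈C-update : ∀ {x : Point q n} {c} i v → x ∈C c → Compatible (lookup c i) v → (x [ i ]≔ v) ∈C c
  ∈C-update {x} {c} i v x∈c compatible j with j ≟ i
  ... | yes refl = subst (Compatible (lookup c i)) (sym (lookup∘update i x v)) compatible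
  ... | no j≢i = subst (Compatible (lookup c j)) (sym (lookup∘update′ j≢i x v)) (x∈c j)

  ∈C-fix : ∀ {x : Point q n} {c} i → x ∈C c → x ∈C c [ i ≔ lookup x i ]
  ∈C-fix {x} {c} i x∈c j with j ≟ i
  ... | yes refl = inj₂ (lookup-fix c i (lookup x i))
  ... | no j≢i = subst (λ m → Compatible m (lookup x j)) (sym (lookup-fix′ c (lookup x i) j≢i)) (x∈c j)

  ∈C-fix⁻ : ∀ {x : Point q n} {c i a} → Compatible (lookup c i) a → x ∈C c [ i ≔ a ] → x ∈C c
  ∈C-fix⁻ {x} {c} {i} {a} compatible x∈ j with j ≟ i
  ... | no j≢i = subst (λ m → Compatible m (lookup x j)) (lookup-fix′ c a j≢i) (x∈ j)
  ... | yes refl with compatible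
  ...   | inj₁ c-free = inj₁ c-free
  ...   | inj₂ c≡a = inj₂ (trans c≡a (cong just (sym (∈C-fixed {x = x} {c = c [ i ≔ a ]} x∈ (lookup-fix c i a)))))

  in-same-cube : ∀ {P : List C} {c d} (x : Point q n) → AllPairs DisjointC P →
                 c ∈ P → d ∈ P → x ∈C c → x ∈C d → c ≡ d
  in-same-cube x (_ ∷ _) (here refl) (here refl) _ _ = refl
  in-same-cube x (c∩ ∷ _) (here refl) (there d∈) x∈c x∈d = ⊥-elim (All.lookup c∩ d∈ x x∈c x∈d)
  in-same-cube x (d∩ ∷ _) (there c∈) (here refl) x∈c x∈d = ⊥-elim (All.lookup d∩ c∈ x x∈d x∈c)
  in-same-cube x (_ ∷ pairs) (there c∈) (there d∈) x∈c x∈d = in-same-cube x pairs c∈ d∈ x∈c x∈d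

  record IsPartitionOf (D : C) (P : List C) : Set where
    field
      disjoint : AllPairs DisjointC P
      inside : ∀ {c} → c ∈ P → c ⊑ D
      covers : ∀ x → x ∈C D → ∃ λ c → c ∈ P × x ∈C c

  open IsPartitionOf public

  FixedIn : List C → Fin n → Set
  FixedIn P i = ∃ λ c → c ∈ P × Fixed c i

  fixedIn? : ∀ P i → Dec (FixedIn P i)
  fixedIn? P i = map′ find (λ (c , c∈ , fixed) → lose c∈ fixed) (Any.any? (λ c → fixed? c i) P)

  compatibleAt? : ∀ i a (c : C) → Dec (Compatible (lookup c i) a)
  compatibleAt? i a c = compatible? (lookup c i) a

  restrict : Fin n → Fin q → List C → List C
  restrict i a P = map (_[ i ≔ a ]) (filter (compatibleAt? i a) P)

  ∈-restrict⁺ : ∀ {i a P c} → c ∈ P → Compatible (lookup c i) a → c [ i ≔ a ] ∈ restrict i a P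
  ∈-restrict⁺ {i} {a} c∈ compatible = ∈-map⁺ (_[ i ≔ a ]) (∈-filter⁺ (compatibleAt? i a) c∈ compatible)

  ∈-restrict⁻ : ∀ {i a P c′} → c′ ∈ restrict i a P → ∃ λ c → c ∈ P × Compatible (lookup c i) a × c′ ≡ c [ i ≔ a ]
  ∈-restrict⁻ {i} {a} c′∈ with ∈-map∘filter⁻ (_[ i ≔ a ]) (compatibleAt? i a) c′∈
  ... | c , c∈ , c′≡ , compatible = c , c∈ , compatible , c′≡

  restrict-partition : ∀ {D P} → IsPartitionOf D P → ∀ {i} → Free D i → ∀ a → IsPartitionOf (D [ i ≔ a ]) (restrict i a P)
  restrict-partition {D} {P} P-part {i} D-free a = record
    { disjoint = AllPairs-map∘filter⁺ (_[ i ≔ a ]) (compatibleAt? i a)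
                   (λ {c} {d} c-compat d-compat c∩d x x∈c x∈d →
                      c∩d x (∈C-fix⁻ {x = x} {c = c} c-compat x∈c) (∈C-fix⁻ {x = x} {c = d} d-compat x∈d))
                   (disjoint P-part)
    ; inside = inside′
    ; covers = covers′
    }
    where
    inside′ : ∀ {c′} → c′ ∈ restrict i a P → c′ ⊑ D [ i ≔ a ]
    inside′ c′∈ with ∈-restrict⁻ c′∈
    ... | c , c∈ , _ , refl = fix-mono i a (inside P-part c∈)
    covers′ : ∀ x → x ∈C D [ i ≔ a ] → ∃ λ c′ → c′ ∈ restrict i a P × x ∈C c′
    covers′ x x∈ with covers P-part x (∈C-fix⁻ {x = x} {c = D} (inj₁ D-free) x∈)
    ... | c , c∈ , x∈c =
      c [ i ≔ a ] , ∈-restrict⁺ c∈ compatible , subst (λ b → x ∈C c [ i ≔ b ]) xᵢ≡a (∈C-fix {x = x} {c = c} i x∈c)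
      where
      xᵢ≡a : lookup x i ≡ a
      xᵢ≡a = ∈C-fixed {x = x} {c = D [ i ≔ a ]} x∈ (lookup-fix D i a)
      compatible : Compatible (lookup c i) a
      compatible = subst (Compatible (lookup c i)) xᵢ≡a (x∈c i)

  -- The cube containing the moved point cannot be free at i, as it would then contain x as well.
  shift-in-partition : ∀ {D P} → IsPartitionOf D P → ∀ {i} → Free D i → ∀ {c} → c ∈ P → Fixed c i →
          ∀ {x} → x ∈C c → ∀ b → ∃ λ d → d ∈ P × lookup d i ≡ just b × (x [ i ]≔ b) ∈C d
  shift-in-partition {D} P-part {i} D-free {c} c∈ c-fixed {x} x∈c b
    with covers P-part (x [ i ]≔ b) (∈C-update {x = x} {c = D} i b (∈C-⊑ {x = x} (inside P-part c∈) x∈c) (inj₁ D-free))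
  ... | d , d∈ , x′∈d with lookup d i in dᵢ
  ...   | just b′ =
    d , d∈ , trans dᵢ (cong just (trans (sym (∈C-fixed {x = x [ i ]≔ b} {c = d} x′∈d dᵢ)) (lookup∘update i x b))) , x′∈d
  ...   | nothing = ⊥-elim (free⇒¬fixed {d} {i} dᵢ (subst (λ e → Fixed e i) c≡d c-fixed))
    where
    x∈d : x ∈C d
    x∈d j with j ≟ i
    ... | yes refl = inj₁ dᵢ
    ... | no j≢i = subst (λ v → Compatible (lookup d j) v) (lookup∘update′ j≢i x b) (x′∈d j)
    c≡d : c ≡ d
    c≡d = in-same-cube x (disjoint P-part) c∈ d∈ x∈c x∈d

  every-value-fixed : ∀ {D P} → IsPartitionOf D P → ∀ {i} → Free D i → FixedIn P i →
                      ∀ b → ∃ λ d → d ∈ P × lookup d i ≡ just b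
  every-value-fixed P-part D-free (c , c∈ , c-fixed) b with shift-in-partition P-part D-free c∈ c-fixed {corner c} (corner∈ c) b
  ... | d , d∈ , dᵢ≡b , _ = d , d∈ , dᵢ≡b

-- The lower bound (q - 1)|L| + 1 ≤ |P|

module LowerBound (r n : ℕ) where
  open Subcubes r n

  record Active (D : C) (P : List C) (L : List (Fin n)) : Set where
    field
      distinct : Unique L
      free : ∀ {j} → j ∈ L → Free D j
      fixedIn : ∀ {j} → j ∈ L → FixedIn P j

  open Active public

  incompatible : Fin n → Fin q → List C → List C
  incompatible i a = filter (∁? (compatibleAt? i a))

  -- Junk value zero where c is free at i; only used on cubes fixed at i.
  valueAt : Fin n → C → Fin q
  valueAt i c = fromMaybe zero (lookup c i)

  otherValues : Fin q → List (Fin q)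
  otherValues a = map (punchIn a) (allFin (suc r))

  Unique-otherValues : ∀ a → Unique (otherValues a)
  Unique-otherValues a = Unique.map⁺ (punchIn-injective a _ _) (Unique.allFin⁺ (suc r))

  length-otherValues : ∀ a → length (otherValues a) ≡ suc r
  length-otherValues a = trans (length-map (punchIn a) (allFin (suc r))) (length-allFin (suc r))

  otherValues⊆ : ∀ {D P} → IsPartitionOf D P → ∀ {i} → Free D i → FixedIn P i →
                 ∀ a → otherValues a ⊆ map (valueAt i) (incompatible i a P)
  otherValues⊆ {D} {P} P-part {i} D-free i-fixed a b∈ with ∈-map⁻ (punchIn a) b∈
  ... | t , _ , refl with every-value-fixed P-part D-free i-fixed (punchIn a t)
  ...   | d , d∈ , dᵢ≡ = subst (_∈ map (valueAt i) (incompatible i a P)) (cong (fromMaybe zero) dᵢ≡)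
                            (∈-map⁺ (valueAt i) (∈-filter⁺ (∁? (compatibleAt? i a)) d∈
                              (punchInᵢ≢i a t ∘ fixed∧compatible⇒≡ dᵢ≡)))

  length-incompatible : ∀ {D P} → IsPartitionOf D P → ∀ {i} → Free D i → FixedIn P i →
                        ∀ a → suc r ≤ length (incompatible i a P)
  length-incompatible {D} {P} P-part {i} D-free i-fixed a = begin
    suc r                                          ≡⟨ length-otherValues a ⟨
    length (otherValues a)                         ≤⟨ unique∧⊆⇒length≤ (Unique-otherValues a) (otherValues⊆ P-part D-free i-fixed a) ⟩
    length (map (valueAt i) (incompatible i a P))  ≡⟨ length-map (valueAt i) (incompatible i a P) ⟩
    length (incompatible i a P)                    ∎
    where open ≤-Reasoning

  length-restrict+length-incompatible : ∀ i a P → length (restrict i a P) + length (incompatible i a P) ≡ length P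
  length-restrict+length-incompatible i a P =
    trans (cong (_+ length (incompatible i a P)) (length-map (_[ i ≔ a ]) (filter (compatibleAt? i a) P)))
          (length-filter+length-filter-∁ (compatibleAt? i a) P)

  length-restrict : ∀ {D P} → IsPartitionOf D P → ∀ {i} → Free D i → FixedIn P i →
                    ∀ a → length (restrict i a P) + suc r ≤ length P
  length-restrict {D} {P} P-part {i} D-free i-fixed a =
    ≤-trans (+-monoʳ-≤ _ (length-incompatible P-part D-free i-fixed a)) (≤-reflexive (length-restrict+length-incompatible i a P))

  Splittable : C → List C → List (Fin n) → Fin n → Set
  Splittable D P L i = ∀ a → Active (D [ i ≔ a ]) (restrict i a P) (delete _≟_ i L)

  -- A coordinate i fixed in as few cubes as possible is splittable: a cube fixing j but free at i is
  -- compatible with every a, and otherwise the cubes fixing j are among those fixing i, so by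
  -- minimality they are the same cubes, among them one with x_i = a.
  ∃-splittable : ∀ {D P L} → IsPartitionOf D P → Active D P L → ∀ {j₀} → j₀ ∈ L →
                 ∃ λ i → i ∈ L × Splittable D P L i
  ∃-splittable {D} {P} {L} P-part L-active {j₀} j₀∈L = i , i∈L , λ a → record
    { distinct = Unique-delete _≟_ (distinct L-active)
    ; free = free′ a
    ; fixedIn = fixedIn′ a
    }
    where
    multiplicity : Fin n → ℕ
    multiplicity j = length (filter (λ c → fixed? c j) P)
    i : Fin n
    i = argmin multiplicity j₀ L
    i∈L : i ∈ L
    i∈L with argmin-sel multiplicity j₀ L
    ... | inj₁ i≡j₀ = subst (_∈ L) (sym i≡j₀) j₀∈L
    ... | inj₂ i∈L = i∈L
    minimal : ∀ {j} → j ∈ L → multiplicity i ≤ multiplicity j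
    minimal = All.lookup (f[argmin]≤f[xs] j₀ L)
    witness : ∀ a {j} → j ∈ L → ∃ λ c → c ∈ P × Fixed c j × Compatible (lookup c i) a
    witness a {j} j∈L with all? (λ c → fixed? c j →-dec fixed? c i) P
    ... | no ¬all with find (¬All⇒Any¬ (λ c → fixed? c j →-dec fixed? c i) P ¬all)
    ...   | c , c∈ , ¬[j⇒i] = c , c∈ , decidable-stable (fixed? c j) (λ ¬fⱼ → ¬[j⇒i] (⊥-elim ∘ ¬fⱼ)) ,
                              inj₁ (¬fixed⇒free {c} {i} (¬[j⇒i] ∘ const))
    witness a {j} j∈L | yes j⇒i with every-value-fixed P-part (free L-active i∈L) (fixedIn L-active i∈L) a
    ... | d , d∈ , dᵢ≡a = d , d∈ , decidable-stable (fixed? d j) ¬¬fⱼ , inj₂ dᵢ≡a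
      where
      ¬¬fⱼ : ¬ ¬ Fixed d j
      ¬¬fⱼ ¬fⱼ = <⇒≱ (length-filter-< (λ c → fixed? c j) (λ c → fixed? c i) P (All.lookup j⇒i) d∈ (a , dᵢ≡a) ¬fⱼ)
                     (minimal j∈L)
    free′ : ∀ a {j} → j ∈ delete _≟_ i L → Free (D [ i ≔ a ]) j
    free′ a j∈ with ∈-delete⁻ _≟_ L j∈
    ... | j∈L , j≢i = trans (lookup-fix′ D a j≢i) (free L-active j∈L)
    fixedIn′ : ∀ a {j} → j ∈ delete _≟_ i L → FixedIn (restrict i a P) j
    fixedIn′ a j∈ with ∈-delete⁻ _≟_ L j∈
    ... | j∈L , j≢i with witness a j∈L
    ...   | c , c∈ , (b , cⱼ≡b) , compatible =
      c [ i ≔ a ] , ∈-restrict⁺ c∈ compatible , b , trans (lookup-fix′ c a j≢i) cⱼ≡b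

  partition-nonempty : ∀ {D P} → IsPartitionOf D P → 1 ≤ length P
  partition-nonempty {D} P-part with covers P-part (corner D) (corner∈ D)
  ... | _ , here _ , _ = s≤s z≤n
  ... | _ , there _ , _ = s≤s z≤n

  bound : ∀ {D P L} → IsPartitionOf D P → Active D P L → suc r * length L + 1 ≤ length P
  bound P-part L-active = bound′ _ refl P-part L-active
    where
    bound′ : ∀ k {D P L} → length L ≡ k → IsPartitionOf D P → Active D P L → suc r * length L + 1 ≤ length P
    bound′ zero {L = []} _ P-part _ = ≤-trans (≤-reflexive (cong (_+ 1) (*-zeroʳ (suc r)))) (partition-nonempty P-part)
    bound′ (suc k) {D} {P} {L@(_ ∷ _)} len P-part L-active = step (∃-splittable P-part L-active (here refl))
      where
      step : (∃ λ i → i ∈ L × Splittable D P L i) → suc r * length L + 1 ≤ length P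
      step (i , i∈L , active′) = begin
        suc r * length L + 1                          ≡⟨ cong (λ l → suc r * l + 1) (length-delete _≟_ (distinct L-active) i∈L) ⟩
        suc r * suc (length L′) + 1                   ≡⟨ m*[1+n]+1≡m*n+1+m (suc r) (length L′) ⟩
        suc r * length L′ + 1 + suc r                 ≤⟨ +-monoˡ-≤ (suc r) (bound′ k len′ (restrict-partition P-part (free L-active i∈L) zero) (active′ zero)) ⟩
        length (restrict i zero P) + suc r            ≤⟨ length-restrict P-part (free L-active i∈L) (fixedIn L-active i∈L) zero ⟩
        length P                                      ∎
        where
        open ≤-Reasoning
        L′ : List (Fin n)
        L′ = delete _≟_ i L
        len′ : length L′ ≡ k
        len′ = suc-injective (trans (sym (length-delete _≟_ (distinct L-active) i∈L)) len)

-- Extremal partitions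

module CommonCoordinate (r n : ℕ) where
  open Subcubes r n
  open LowerBound r n

  -- Two cubes with value b, plus one cube for each value other than a and b, would be q cubes
  -- incompatible with a.
  fibre-unique : ∀ {D P} → IsPartitionOf D P → ∀ {i} → Free D i → FixedIn P i →
                 (∀ a → length (incompatible i a P) ≤ suc r) →
                 ∀ {c c′ b} → c ∈ P → c′ ∈ P → lookup c i ≡ just b → lookup c′ i ≡ just b → c ≡ c′
  fibre-unique {D} {P} P-part {i} D-free i-fixed few {c} {c′} {b} c∈ c′∈ cᵢ≡b c′ᵢ≡b =
    decidable-stable (Vec.≡-dec (Maybe.≡-dec _≟_) c c′) λ c≢c′ → n≮n (suc r) (begin-strict
      suc r                        ≡⟨ length-otherValues a ⟨
      length (otherValues a)       <⟨ unique∧⊆map⇒length< (valueAt i) (Unique-otherValues a) (otherValues⊆ P-part D-free i-fixed a)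
                                        (incompatible∋ c∈ cᵢ≡b) (incompatible∋ c′∈ c′ᵢ≡b) (c≢c′ ∘ sym)
                                        (cong (fromMaybe zero) (trans cᵢ≡b (sym c′ᵢ≡b))) ⟩
      length (incompatible i a P)  ≤⟨ few a ⟩
      suc r                        ∎)
    where
    open ≤-Reasoning
    a : Fin q
    a = punchIn b zero
    incompatible∋ : ∀ {d} → d ∈ P → lookup d i ≡ just b → d ∈ incompatible i a P
    incompatible∋ d∈ dᵢ≡b = ∈-filter⁺ (∁? (compatibleAt? i a)) d∈ (punchInᵢ≢i b zero ∘ sym ∘ fixed∧compatible⇒≡ dᵢ≡b)

  all-fixed-if-q-cubes : ∀ {D P} → IsPartitionOf D P → ∀ {i} → Free D i → FixedIn P i → length P ≡ q →
                         ∀ {c} → c ∈ P → Fixed c i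
  all-fixed-if-q-cubes {D} {P} P-part {i} D-free i-fixed len {c} c∈ =
    decidable-stable (fixed? c i) λ ¬fixed → n≮n q (begin-strict
      q                                   ≡⟨ trans (length-map just (allFin q)) (length-allFin q) ⟨
      length (map just (allFin q))        <⟨ n<1+n _ ⟩
      length entries                      ≤⟨ unique∧⊆⇒length≤ Unique-entries (entries⊆ ¬fixed) ⟩
      length (map (λ d → lookup d i) P)   ≡⟨ trans (length-map (λ d → lookup d i) P) len ⟩
      q                                   ∎)
    where
    open ≤-Reasoning
    entries : List (Maybe (Fin q))
    entries = nothing ∷ map just (allFin q)
    Unique-entries : Unique entries
    Unique-entries = All.tabulate (λ m∈ → nothing≢ (∈-map⁻ just m∈)) ∷ Unique.map⁺ just-injective (Unique.allFin⁺ q)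
      where
      nothing≢ : ∀ {m} → ∃ (λ b → b ∈ allFin q × m ≡ just b) → nothing ≢ m
      nothing≢ (b , _ , refl) ()
    entries⊆ : ¬ Fixed c i → entries ⊆ map (λ d → lookup d i) P
    entries⊆ ¬fixed (here refl) = subst (_∈ map (λ d → lookup d i) P) (¬fixed⇒free {c} {i} ¬fixed) (∈-map⁺ (λ d → lookup d i) c∈)
    entries⊆ ¬fixed (there m∈) with ∈-map⁻ just m∈
    ... | b , _ , refl with every-value-fixed P-part D-free i-fixed b
    ...   | d , d∈ , dᵢ≡b = subst (_∈ map (λ d → lookup d i) P) dᵢ≡b (∈-map⁺ (λ d → lookup d i) d∈)

  -- Two points of c differing only at t would be shifted to the same cube of the 0-fibre, which fixes t.
  fixed-beyond-zero-fibre : ∀ {D P} → IsPartitionOf D P → ∀ {i t} → Free D i → t ≢ i →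
    (∀ {d d′} → d ∈ P → d′ ∈ P → lookup d i ≡ just zero → lookup d′ i ≡ just zero → d ≡ d′) →
    (∀ {d} → d ∈ P → lookup d i ≡ just zero → Fixed d t) →
    ∀ {c} → c ∈ P → Fixed c i → Fixed c t
  fixed-beyond-zero-fibre {D} {P} P-part {i} {t} D-free t≢i zero-fibre-unique zero-fibre-fixed {c} c∈ c-fixed =
    decidable-stable (fixed? c t) two-points
    where
    x : Fin q → Point q n
    x v = corner c [ t ]≔ v
    x∈c : ¬ Fixed c t → ∀ v → x v ∈C c
    x∈c ¬fixed v = ∈C-update {x = corner c} {c = c} t v (corner∈ c) (inj₁ (¬fixed⇒free {c} {t} ¬fixed))
    two-points : ¬ ¬ Fixed c t
    two-points ¬fixed with shift-in-partition P-part D-free c∈ c-fixed {x zero} (x∈c ¬fixed zero) zero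
                         | shift-in-partition P-part D-free c∈ c-fixed {x (suc zero)} (x∈c ¬fixed (suc zero)) zero
    ... | d , d∈ , dᵢ≡0 , x₀∈d | d′ , d′∈ , d′ᵢ≡0 , x₁∈d′ with zero-fibre-unique d∈ d′∈ dᵢ≡0 d′ᵢ≡0
    ...   | refl with zero-fibre-fixed d∈ dᵢ≡0
    ...     | w , dₜ≡w = Finₚ.0≢1+n (trans (value-at-t zero x₀∈d) (sym (value-at-t (suc zero) x₁∈d′)))
      where
      value-at-t : ∀ v → (x v [ i ]≔ zero) ∈C d → v ≡ w
      value-at-t v x′∈d = begin
        v                          ≡⟨ lookup∘update t (corner c) v ⟨
        lookup (x v) t             ≡⟨ lookup∘update′ t≢i (x v) zero ⟨
        lookup (x v [ i ]≔ zero) t ≡⟨ ∈C-fixed {x = x v [ i ]≔ zero} {c = d} x′∈d dₜ≡w ⟩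
        w                          ∎
        where open ≡-Reasoning

  -- Cubes compatible with x_i = 0 fix t because their traces do; the others are fixed at i to a
  -- nonzero value and are handled by fixed-beyond-zero-fibre.
  lift-from-zero-slab : ∀ {D P} → IsPartitionOf D P → ∀ {i} → Free D i → FixedIn P i →
                        (∀ a → length (incompatible i a P) ≤ suc r) →
                        ∀ {t} → Free (D [ i ≔ zero ]) t → (∀ {c′} → c′ ∈ restrict i zero P → Fixed c′ t) →
                        Free D t × (∀ {c} → c ∈ P → Fixed c t)
  lift-from-zero-slab {D} {P} P-part {i} D-free i-fixed few {t} D₀-free fixed₀ =
    trans (sym (lookup-fix′ D zero t≢i)) D₀-free , fixed
    where
    t≢i : t ≢ i
    t≢i refl with trans (sym (lookup-fix D t zero)) D₀-free
    ... | ()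
    fixed-if-compatible : ∀ {c} → c ∈ P → Compatible (lookup c i) zero → Fixed c t
    fixed-if-compatible {c} c∈ compatible with fixed₀ (∈-restrict⁺ c∈ compatible)
    ... | b , cₜ≡b = b , trans (sym (lookup-fix′ c zero t≢i)) cₜ≡b
    fixed : ∀ {c} → c ∈ P → Fixed c t
    fixed {c} c∈ with compatibleAt? i zero c
    ... | yes compatible = fixed-if-compatible c∈ compatible
    ... | no incompatible =
      fixed-beyond-zero-fibre P-part D-free t≢i (fibre-unique P-part D-free i-fixed few)
        (λ d∈ dᵢ≡0 → fixed-if-compatible d∈ (inj₂ dᵢ≡0))
        c∈ (decidable-stable (fixed? c i) (λ ¬fixed → incompatible (inj₁ (¬fixed⇒free {c} {i} ¬fixed))))

  -- In the extremal case, restricting to x_i = 0 at a splittable i stays extremal and each value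
  -- at i is taken by a single cube; induction then provides t.
  common-fixed : ∀ {D P L} → IsPartitionOf D P → Active D P L → 1 ≤ length L → suc r * length L + 1 ≡ length P →
                 ∃ λ t → Free D t × (∀ {c} → c ∈ P → Fixed c t)
  common-fixed {L = _ ∷ L₀} P-part L-active _ tight = common-fixed′ (length L₀) refl P-part L-active tight
    where
    common-fixed′ : ∀ k {D P L} → length L ≡ suc k → IsPartitionOf D P → Active D P L →
                    suc r * length L + 1 ≡ length P → ∃ λ t → Free D t × (∀ {c} → c ∈ P → Fixed c t)
    common-fixed′ k {D} {P} {L@(_ ∷ _)} len P-part L-active tight = split (∃-splittable P-part L-active (here refl))
      where
      split : (∃ λ i → i ∈ L × Splittable D P L i) → ∃ λ t → Free D t × (∀ {c} → c ∈ P → Fixed c t)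
      split (i , i∈L , active′) = lift k len
        where
        D-free : Free D i
        D-free = free L-active i∈L
        i-fixed : FixedIn P i
        i-fixed = fixedIn L-active i∈L
        L′ : List (Fin n)
        L′ = delete _≟_ i L
        len-L : length L ≡ suc (length L′)
        len-L = length-delete _≟_ (distinct L-active) i∈L
        len-P : length P ≡ suc r * length L′ + 1 + suc r
        len-P = trans (sym tight) (trans (cong (λ l → suc r * l + 1) len-L) (m*[1+n]+1≡m*n+1+m (suc r) (length L′)))
        few : ∀ a → length (incompatible i a P) ≤ suc r
        few a = +-cancelˡ-≤ (suc r * length L′ + 1) _ _ (begin
          suc r * length L′ + 1 + length (incompatible i a P)   ≤⟨ +-monoˡ-≤ _ (bound (restrict-partition P-part D-free a) (active′ a)) ⟩
          length (restrict i a P) + length (incompatible i a P) ≡⟨ length-restrict+length-incompatible i a P ⟩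
          length P                                              ≡⟨ len-P ⟩
          suc r * length L′ + 1 + suc r                         ∎)
          where open ≤-Reasoning
        lift : ∀ k → length L ≡ suc k → ∃ λ t → Free D t × (∀ {c} → c ∈ P → Fixed c t)
        lift zero len = i , D-free , all-fixed-if-q-cubes P-part D-free i-fixed (begin
          length P                        ≡⟨ len-P ⟩
          suc r * length L′ + 1 + suc r   ≡⟨ cong (λ l → suc r * l + 1 + suc r) (suc-injective (trans (sym len-L) len)) ⟩
          suc r * 0 + 1 + suc r           ≡⟨ cong (λ z → z + 1 + suc r) (*-zeroʳ (suc r)) ⟩
          q                               ∎)
          where open ≡-Reasoning
        lift (suc k′) len = let t , D₀-free , fixed₀ = common-fixed′ k′ len′ P₀-part (active′ zero) tight₀ in
                            t , lift-from-zero-slab P-part D-free i-fixed few D₀-free fixed₀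
          where
          len′ : length L′ ≡ suc k′
          len′ = suc-injective (trans (sym len-L) len)
          P₀-part : IsPartitionOf (D [ i ≔ zero ]) (restrict i zero P)
          P₀-part = restrict-partition P-part D-free zero
          tight₀ : suc r * length L′ + 1 ≡ length (restrict i zero P)
          tight₀ = ≤-antisym (bound P₀-part (active′ zero))
                     (+-cancelʳ-≤ (suc r) _ _ (≤-trans (length-restrict P-part D-free i-fixed zero) (≤-reflexive len-P)))

-- Decision trees

-- Number of labels of a q-ary tree of depth m: its root label and q subtrees of depth m - 1.
treeSize : ℕ → ℕ → ℕ
treeSize q zero = 0
treeSize q (suc m) = suc (q * treeSize q m)

treeSize-formula : ∀ p m → p * treeSize (suc p) m + 1 ≡ suc p ^ m
treeSize-formula p zero = cong (_+ 1) (*-zeroʳ p)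
treeSize-formula p (suc m) = trans (regroup p (treeSize (suc p) m)) (cong (suc p *_) (treeSize-formula p m))
  where
  regroup : ∀ p s → p * suc (suc p * s) + 1 ≡ suc p * (p * s + 1)
  regroup = solve-∀

hOf≡treeSize : ∀ r m → hOf (suc (suc r)) m ≡ treeSize (suc (suc r)) m
hOf≡treeSize r m = begin
  (suc (suc r) ^ m ∸ 1) / suc r         ≡⟨ cong (λ x → (x ∸ 1) / suc r) (treeSize-formula (suc r) m) ⟨
  (suc r * s + 1 ∸ 1) / suc r           ≡⟨ cong (_/ suc r) (trans (m+n∸n≡m (suc r * s) 1) (*-comm (suc r) s)) ⟩
  (s * suc r) / suc r                   ≡⟨ m*n/n≡m s (suc r) ⟩
  s                                     ∎
  where
  open ≡-Reasoning
  s : ℕ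
  s = treeSize (suc (suc r)) m

module Trees (r n : ℕ) where
  open Subcubes r n

  size : ℕ → ℕ
  size = treeSize q

  -- The partition of D obtained by splitting along the first label and recursing into the q slabs,
  -- each taking its own block of the remaining labels.
  tree : C → ℕ → List (Fin n) → List C
  tree D zero _ = D ∷ []
  tree D (suc m) [] = []
  tree D (suc m) (i ∷ ℓ) = ⋃ λ a → tree (D [ i ≔ a ]) m (chunk q (size m) ℓ a)

  subtree : C → ℕ → Fin n → List (Fin n) → Fin q → List C
  subtree D m i ℓ a = tree (D [ i ≔ a ]) m (chunk q (size m) ℓ a)

  record Labelling (D : C) (m : ℕ) (ℓ : List (Fin n)) : Set where
    field
      unique : Unique ℓ
      sized : length ℓ ≡ size m
      free-at : ∀ {j} → j ∈ ℓ → Free D j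

  open Labelling public

  child : ∀ {D m i ℓ} → Labelling D (suc m) (i ∷ ℓ) → ∀ a → Labelling (D [ i ≔ a ]) m (chunk q (size m) ℓ a)
  child {D} {m} {i} {ℓ} lab a with unique lab
  ... | i∉ℓ ∷ ℓ-unique = record
    { unique = Unique-chunk q (size m) ℓ-unique a
    ; sized = length-chunk q (size m) ℓ (suc-injective (sized lab)) a
    ; free-at = λ j∈ → let j∈ℓ = chunk-⊆ q (size m) ℓ a j∈ in
                 trans (lookup-fix′ D a (λ j≡i → All.lookup i∉ℓ j∈ℓ (sym j≡i))) (free-at lab (there j∈ℓ))
    }

  tree-partition : ∀ {D m ℓ} → Labelling D m ℓ → IsPartitionOf D (tree D m ℓ)
  tree-partition {D} {zero} {ℓ} _ = record
    { disjoint = All.[] ∷ []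
    ; inside = λ { (here refl) → ⊑-refl }
    ; covers = λ x x∈D → D , here refl , x∈D
    }
  tree-partition {D} {suc m} {i ∷ ℓ} lab = record
    { disjoint = AllPairs-⋃ (subtree D m i ℓ) (disjoint ∘ part) across
    ; inside = inside′
    ; covers = covers′
    }
    where
    part : ∀ a → IsPartitionOf (D [ i ≔ a ]) (subtree D m i ℓ a)
    part a = tree-partition (child lab a)
    root : ∀ a {c} → c ∈ subtree D m i ℓ a → lookup c i ≡ just a
    root a c∈ = ⊑-fix⇒≡ i a (inside (part a) c∈)
    across : ∀ {a b c d} → a ≢ b → c ∈ subtree D m i ℓ a → d ∈ subtree D m i ℓ b → DisjointC c d
    across {a} {b} {c} {d} a≢b c∈ d∈ x x∈c x∈d =
      a≢b (trans (sym (∈C-fixed {x = x} {c = c} x∈c (root a c∈))) (∈C-fixed {x = x} {c = d} x∈d (root b d∈)))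
    inside′ : ∀ {c} → c ∈ tree D (suc m) (i ∷ ℓ) → c ⊑ D
    inside′ c∈ with ∈-⋃⁻ (subtree D m i ℓ) c∈
    ... | a , c∈ₐ = ⊑-trans (inside (part a) c∈ₐ) (fix-⊑ a (free-at lab (here refl)))
    covers′ : ∀ x → x ∈C D → ∃ λ c → c ∈ tree D (suc m) (i ∷ ℓ) × x ∈C c
    covers′ x x∈D with covers (part (lookup x i)) x (∈C-fix {x = x} {c = D} i x∈D)
    ... | c , c∈ , x∈c = c , ∈-⋃⁺ (subtree D m i ℓ) (lookup x i) c∈ , x∈c

  subtree-fixes-root : ∀ {D m i ℓ} → Labelling D (suc m) (i ∷ ℓ) → ∀ a {c} → c ∈ subtree D m i ℓ a → lookup c i ≡ just a
  subtree-fixes-root {i = i} lab a c∈ = ⊑-fix⇒≡ i a (inside (tree-partition (child lab a)) c∈)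

  length-tree : ∀ {D m ℓ} → Labelling D m ℓ → length (tree D m ℓ) ≡ q ^ m
  length-tree {D} {zero} _ = refl
  length-tree {D} {suc m} {i ∷ ℓ} lab =
    trans (length-⋃ (subtree D m i ℓ)) (trans (∑-cong (length-tree ∘ child lab)) (∑-const q (q ^ m)))

  dim-tree : ∀ {D m ℓ} → Labelling D m ℓ → ∀ {c} → c ∈ tree D m ℓ → dim c + m ≡ dim D
  dim-tree {D} {zero} _ (here refl) = +-identityʳ (dim D)
  dim-tree {D} {suc m} {i ∷ ℓ} lab {c} c∈ with ∈-⋃⁻ (subtree D m i ℓ) c∈
  ... | a , c∈ₐ = trans (+-suc (dim c) m) (trans (cong suc (dim-tree (child lab a) c∈ₐ)) (dim-fix D i a (free-at lab (here refl))))

  tree-fixes-labels : ∀ {D m ℓ} → Labelling D m ℓ → ∀ {j} → j ∈ ℓ → FixedIn (tree D m ℓ) j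
  tree-fixes-labels {D} {suc m} {i ∷ ℓ} lab (here refl) with covers (tree-partition lab) (corner D) (corner∈ D)
  ... | c , c∈ , _ with ∈-⋃⁻ (subtree D m i ℓ) c∈
  ...   | a , c∈ₐ = c , c∈ , a , subtree-fixes-root lab a c∈ₐ
  tree-fixes-labels {D} {suc m} {i ∷ ℓ} lab (there j∈ℓ) with ∈-chunk q (size m) ℓ (suc-injective (sized lab)) j∈ℓ
  ... | a , j∈ₐ with tree-fixes-labels (child lab a) j∈ₐ
  ...   | c , c∈ , c-fixed = c , ∈-⋃⁺ (subtree D m i ℓ) a c∈ , c-fixed

  fixed-in-tree : ∀ {D m ℓ c j} → Labelling D m ℓ → c ∈ tree D m ℓ → Fixed c j → Fixed D j ⊎ j ∈ ℓ
  fixed-in-tree {D} {zero} _ (here refl) c-fixed = inj₁ c-fixed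
  fixed-in-tree {D} {suc m} {i ∷ ℓ} {c} {j} lab c∈ c-fixed with ∈-⋃⁻ (subtree D m i ℓ) c∈
  ... | a , c∈ₐ with fixed-in-tree (child lab a) c∈ₐ c-fixed
  ...   | inj₂ j∈ₐ = inj₂ (there (chunk-⊆ q (size m) ℓ a j∈ₐ))
  ...   | inj₁ (b , Dⱼ≡b) with j ≟ i
  ...     | yes refl = inj₂ (here refl)
  ...     | no j≢i = inj₁ (b , trans (sym (lookup-fix′ D a j≢i)) Dⱼ≡b)

  valued? : ∀ i b (c : C) → Dec (lookup c i ≡ just b)
  valued? i b c = Maybe.≡-dec _≟_ (lookup c i) (just b)

  filter-tree : ∀ {D m i ℓ} → Labelling D (suc m) (i ∷ ℓ) → ∀ b →
                filter (valued? i b) (tree D (suc m) (i ∷ ℓ)) ≡ subtree D m i ℓ b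
  filter-tree {D} {m} {i} {ℓ} lab b = begin
    filter (valued? i b) (⋃ (subtree D m i ℓ))   ≡⟨ filter-⋃ (valued? i b) (subtree D m i ℓ) ⟩
    ⋃ (filter (valued? i b) ∘ subtree D m i ℓ)   ≡⟨ ⋃-single (filter (valued? i b) ∘ subtree D m i ℓ) b others-empty ⟩
    filter (valued? i b) (subtree D m i ℓ b)     ≡⟨ filter-all (valued? i b) (All.tabulate (subtree-fixes-root lab b)) ⟩
    subtree D m i ℓ b                            ∎
    where
    open ≡-Reasoning
    others-empty : ∀ a → a ≢ b → filter (valued? i b) (subtree D m i ℓ a) ≡ []
    others-empty a a≢b = filter-none (valued? i b) (All.tabulate λ c∈ cᵢ≡b →
      a≢b (just-injective (trans (sym (subtree-fixes-root lab a c∈)) cᵢ≡b)))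

  -- A label i′ other than the root lies in at most one of the q ≥ 2 blocks; in a slab whose block
  -- avoids i′, some cube is free at i′.
  root-unique : ∀ {D m i ℓ} → Labelling D (suc m) (i ∷ ℓ) → ∀ {i′} → Free D i′ →
                (∀ {c} → c ∈ tree D (suc m) (i ∷ ℓ) → Fixed c i′) → i′ ≡ i
  root-unique {D} {m} {i} {ℓ} lab {i′} D-free fixed-everywhere with i′ ≟ i
  ... | yes i′≡i = i′≡i
  ... | no i′≢i with avoiding-block
    where
    avoiding-block : ∃ λ b → ¬ i′ ∈ chunk q (size m) ℓ b
    avoiding-block with DecMembership._∈?_ _≟_ i′ (chunk q (size m) ℓ zero)
    ... | no i′∉₀ = zero , i′∉₀
    ... | yes i′∈₀ = suc zero , chunk-disjoint q (size m) (AllPairs.tail (unique lab)) {zero} {suc zero} (λ ()) i′∈₀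
  ...   | b , i′∉b with covers (tree-partition (child lab b)) (corner (D [ i ≔ b ])) (corner∈ (D [ i ≔ b ]))
  ...     | c , c∈ , _ with fixed-in-tree (child lab b) c∈ (fixed-everywhere (∈-⋃⁺ (subtree D m i ℓ) b c∈))
  ...       | inj₁ (v , Dᵢ′≡v) = ⊥-elim (free⇒¬fixed {D} {i′} D-free (v , trans (sym (lookup-fix′ D b i′≢i)) Dᵢ′≡v))
  ...       | inj₂ i′∈b = ⊥-elim (i′∉b i′∈b)

  tree-injective : ∀ {D m ℓ ℓ′} → Labelling D m ℓ → Labelling D m ℓ′ → tree D m ℓ ↭ tree D m ℓ′ → ℓ ≡ ℓ′
  tree-injective {D} {zero} {[]} {[]} _ _ _ = refl
  tree-injective {D} {suc m} {i ∷ ℓ} {i′ ∷ ℓ′} lab lab′ p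
    with root-unique lab (free-at lab′ (here refl)) fixed-at-i′
    where
    fixed-at-i′ : ∀ {c} → c ∈ tree D (suc m) (i ∷ ℓ) → Fixed c i′
    fixed-at-i′ c∈ with ∈-⋃⁻ (subtree D m i′ ℓ′) (∈-resp-↭ p c∈)
    ... | a , c∈ₐ = a , subtree-fixes-root lab′ a c∈ₐ
  ... | refl = cong (i ∷_) (begin
    ℓ                               ≡⟨ ⋃-chunk q (size m) ℓ (suc-injective (sized lab)) ⟨
    ⋃ (chunk q (size m) ℓ)          ≡⟨ ⋃-cong same-blocks ⟩
    ⋃ (chunk q (size m) ℓ′)         ≡⟨ ⋃-chunk q (size m) ℓ′ (suc-injective (sized lab′)) ⟩
    ℓ′                              ∎)
    where
    open ≡-Reasoning
    same-blocks : ∀ b → chunk q (size m) ℓ b ≡ chunk q (size m) ℓ′ b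
    same-blocks b = tree-injective (child lab b) (child lab′ b)
      (subst₂ _↭_ (filter-tree lab b) (filter-tree lab′ b) (filter-↭ (valued? i b) p))

module ExtremalStructure (r n : ℕ) where
  open Subcubes r n
  open LowerBound r n
  open CommonCoordinate r n
  open Trees r n

  record Extremal (D : C) (m : ℕ) (P : List C) (L : List (Fin n)) : Set where
    field
      partition : IsPartitionOf D P
      codim : ∀ {c} → c ∈ P → dim c + m ≡ dim D
      active : Active D P L
      tight : suc r * length L + 1 ≡ length P

  record TreeOf (D : C) (m : ℕ) (P : List C) (L : List (Fin n)) : Set where
    field
      labels : List (Fin n)
      labelling : Labelling D m labels
      labels⊆ : labels ⊆ L
      ↭-tree : P ↭ tree D m labels

  open Extremal
  open TreeOf

  extremal-depth-zero : ∀ {D P L} → Extremal D zero P L → TreeOf D zero P L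
  extremal-depth-zero {D} {P} {L} E = record
    { labels = []
    ; labelling = record { unique = [] ; sized = refl ; free-at = λ () }
    ; labels⊆ = λ ()
    ; ↭-tree = single P (disjoint (partition E)) (partition-nonempty (partition E))
                 (λ c∈ → dim-⊑-≡ (inside (partition E) c∈) (trans (sym (+-identityʳ _)) (codim E c∈)))
    }
    where
    single : ∀ P → AllPairs DisjointC P → 1 ≤ length P → (∀ {c} → c ∈ P → c ≡ D) → P ↭ D ∷ []
    single (c ∷ []) _ _ all-D rewrite all-D (here refl) = ↭-refl
    single (c ∷ d ∷ _) (c∩ ∷ _) _ all-D =
      ⊥-elim (All.head c∩ (corner D) (subst (corner D ∈C_) (sym (all-D (here refl))) (corner∈ D))
                                    (subst (corner D ∈C_) (sym (all-D (there (here refl)))) (corner∈ D)))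

  -- With no labels P is a single cube of positive codimension, which misses points of D.
  extremal-without-labels : ∀ {D m P} → ¬ Extremal D (suc m) P []
  extremal-without-labels {D} {m} {P} E =
    single-cube P (trans (sym (tight E)) (cong (_+ 1) (*-zeroʳ (suc r)))) (partition E) (codim E)
    where
    single-cube : ∀ P → length P ≡ 1 → IsPartitionOf D P → (∀ {c} → c ∈ P → dim c + suc m ≡ dim D) → ⊥
    single-cube (c ∷ []) _ P-part codim′ with dim-⊑-< (inside P-part (here refl)) (begin-strict
        dim c              <⟨ m<m+n (dim c) z<s ⟩
        dim c + suc m      ≡⟨ codim′ (here refl) ⟩
        dim D              ∎)
      where open ≤-Reasoning
    ... | j , Dⱼ-free , a , cⱼ≡a with covers P-part x x∈D
      where
      x : Point q n
      x = corner c [ j ]≔ punchIn a zero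
      x∈D : x ∈C D
      x∈D = ∈C-update {x = corner c} {c = D} j (punchIn a zero)
              (∈C-⊑ {x = corner c} (inside P-part (here refl)) (corner∈ c)) (inj₁ Dⱼ-free)
    ...   | .c , here refl , x∈c =
      punchInᵢ≢i a zero (trans (sym (lookup∘update j (corner c) (punchIn a zero)))
                               (∈C-fixed {x = corner c [ j ]≔ punchIn a zero} {c = c} x∈c cⱼ≡a))

  -- The coordinate fixed in every cube is active, since adding it to L would beat the bound.
  common-label : ∀ {D m P L} → Extremal D (suc m) P L → ∃ λ i → i ∈ L × (∀ {c} → c ∈ P → Fixed c i)
  common-label {L = []} E = ⊥-elim (extremal-without-labels E)
  common-label {D} {m} {P} {L@(_ ∷ _)} E = active-or-contradiction (common-fixed (partition E) (active E) (s≤s z≤n) (tight E))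
    where
    active-or-contradiction : (∃ λ t → Free D t × (∀ {c} → c ∈ P → Fixed c t)) →
                              ∃ λ i → i ∈ L × (∀ {c} → c ∈ P → Fixed c i)
    active-or-contradiction (t , D-free , fixed-at-t) with DecMembership._∈?_ _≟_ t L
    ... | yes t∈L = t , t∈L , fixed-at-t
    ... | no t∉L = ⊥-elim (n≮n (suc r * length L + 1) (begin-strict
        suc r * length L + 1               <⟨ m<m+n _ z<s ⟩
        suc r * length L + 1 + suc r       ≡⟨ m*[1+n]+1≡m*n+1+m (suc r) (length L) ⟨
        suc r * length (t ∷ L) + 1         ≤⟨ bound (partition E) active′ ⟩
        length P                           ≡⟨ tight E ⟨
        suc r * length L + 1               ∎))
      where
      open ≤-Reasoning
      active′ : Active D P (t ∷ L)
      active′ = record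
        { distinct = All.tabulate (λ j∈L t≡j → t∉L (subst (_∈ L) (sym t≡j) j∈L)) ∷ distinct (active E)
        ; free = λ { (here refl) → D-free ; (there j∈L) → free (active E) j∈L }
        ; fixedIn = λ { (here refl) → let c , c∈ , _ = covers (partition E) (corner D) (corner∈ D) in c , c∈ , fixed-at-t c∈
                      ; (there j∈L) → fixedIn (active E) j∈L }
        }

  module Slabs {D m P L} (E : Extremal D (suc m) P L) {i} (i∈L : i ∈ L) (fixed-at-i : ∀ {c} → c ∈ P → Fixed c i) where

    D-free : Free D i
    D-free = free (active E) i∈L

    M : List (Fin n)
    M = delete _≟_ i L

    slab : Fin q → List C
    slab a = restrict i a P

    slab-labels : Fin q → List (Fin n)
    slab-labels a = filter (fixedIn? (slab a)) M

    value-at-i : ∀ {c} → c ∈ P → ∀ {a} → Compatible (lookup c i) a → lookup c i ≡ just a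
    value-at-i c∈ (inj₂ cᵢ≡a) = cᵢ≡a
    value-at-i {c} c∈ (inj₁ cᵢ-free) = ⊥-elim (free⇒¬fixed {c} {i} cᵢ-free (fixed-at-i c∈))

    slab≡filter : ∀ a → slab a ≡ filter (compatibleAt? i a) P
    slab≡filter a = map-id-local (All.tabulate λ c∈ →
      let c∈P , compatible = ∈-filter⁻ (compatibleAt? i a) c∈ in fix-fixed (value-at-i c∈P compatible))

    P↭slabs : P ↭ ⋃ slab
    P↭slabs = ↭-trans (↭-⋃-filter (compatibleAt? i) P unique-value) (↭-reflexive (⋃-cong (sym ∘ slab≡filter)))
      where
      unique-value : ∀ {c} → c ∈ P → ∃ λ b → Compatible (lookup c i) b × (∀ a → Compatible (lookup c i) a → a ≡ b)
      unique-value c∈ with fixed-at-i c∈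
      ... | b , cᵢ≡b = b , inj₂ cᵢ≡b , λ a compatible → just-injective (trans (sym (value-at-i c∈ compatible)) cᵢ≡b)

    slab-codim : ∀ a {c′} → c′ ∈ slab a → dim c′ + m ≡ dim (D [ i ≔ a ])
    slab-codim a c′∈ with ∈-restrict⁻ c′∈
    ... | c , c∈ , compatible , refl = begin
      dim (c [ i ≔ a ]) + m   ≡⟨ cong (λ e → dim e + m) (fix-fixed {c} (value-at-i c∈ compatible)) ⟩
      dim c + m               ≡⟨ suc-injective (trans (sym (+-suc (dim c) m)) (trans (codim E c∈) (sym (dim-fix D i a D-free)))) ⟩
      dim (D [ i ≔ a ])       ∎
      where open ≡-Reasoning

    slab-active : ∀ a → Active (D [ i ≔ a ]) (slab a) (slab-labels a)
    slab-active a = record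
      { distinct = Unique.filter⁺ (fixedIn? (slab a)) (Unique-delete _≟_ (distinct (active E)))
      ; free = free′
      ; fixedIn = λ j∈ → proj₂ (∈-filter⁻ (fixedIn? (slab a)) {xs = M} j∈)
      }
      where
      free′ : ∀ {j} → j ∈ slab-labels a → Free (D [ i ≔ a ]) j
      free′ j∈ with ∈-delete⁻ _≟_ L (proj₁ (∈-filter⁻ (fixedIn? (slab a)) {xs = M} j∈))
      ... | j∈L , j≢i = trans (lookup-fix′ D a j≢i) (free (active E) j∈L)

    in-some-slab : ∀ {j} → j ∈ M → ∃ λ a → FixedIn (slab a) j
    in-some-slab j∈M with ∈-delete⁻ _≟_ L j∈M
    ... | j∈L , j≢i with fixedIn (active E) j∈L
    ...   | c , c∈ , v , cⱼ≡v with fixed-at-i c∈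
    ...     | b , cᵢ≡b = b , c [ i ≔ b ] , ∈-restrict⁺ c∈ (inj₂ cᵢ≡b) , v , trans (lookup-fix′ c b j≢i) cⱼ≡v

    lower : Fin q → ℕ
    lower a = suc r * length (slab-labels a) + 1

    ∑lower : ∑ lower ≡ suc r * ∑ (length ∘ slab-labels) + q
    ∑lower = trans (∑-distrib-+ (λ a → suc r * length (slab-labels a)) (λ _ → 1))
                   (cong₂ _+_ (*-distribˡ-∑ (suc r) (length ∘ slab-labels)) (trans (∑-const q 1) (*-identityʳ q)))

    ∑slab : ∑ (length ∘ slab) ≡ suc r * length M + q
    ∑slab = begin
      ∑ (length ∘ slab)                ≡⟨ trans (↭-length P↭slabs) (length-⋃ slab) ⟨
      length P                         ≡⟨ tight E ⟨
      suc r * length L + 1             ≡⟨ cong (λ l → suc r * l + 1) (length-delete _≟_ (distinct (active E)) i∈L) ⟩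
      suc r * suc (length M) + 1       ≡⟨ m*[1+n]+1≡m*n+1+m (suc r) (length M) ⟩
      suc r * length M + 1 + suc r     ≡⟨ +-assoc _ 1 (suc r) ⟩
      suc r * length M + q             ∎
      where open ≡-Reasoning

    lower≤slab : ∀ a → lower a ≤ length (slab a)
    lower≤slab a = bound (restrict-partition (partition E) D-free a) (slab-active a)

    -- Every label lies in some slab, so ∑ lower ≥ ∑ |slab|: all the slab bounds are equalities.
    slab-tight : ∀ a → lower a ≡ length (slab a)
    slab-tight = ∑-mono-≤-tight lower≤slab (begin
      ∑ (length ∘ slab)                      ≡⟨ ∑slab ⟩
      suc r * length M + q                   ≤⟨ +-monoˡ-≤ q (*-monoʳ-≤ (suc r) covered) ⟩
      suc r * ∑ (length ∘ slab-labels) + q   ≡⟨ ∑lower ⟨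
      ∑ lower                                ∎)
      where
      open ≤-Reasoning
      covered : length M ≤ ∑ (length ∘ slab-labels)
      covered = length≤∑length-filter (λ a → fixedIn? (slab a)) M in-some-slab

    ∑labels≤ : ∑ (length ∘ slab-labels) ≤ length M
    ∑labels≤ = *-cancelˡ-≤ (suc r) (+-cancelʳ-≤ q _ _ (begin
      suc r * ∑ (length ∘ slab-labels) + q   ≡⟨ ∑lower ⟨
      ∑ lower                                ≤⟨ ∑-mono-≤ lower≤slab ⟩
      ∑ (length ∘ slab)                      ≡⟨ ∑slab ⟩
      suc r * length M + q                   ∎))
      where open ≤-Reasoning

    labels-disjoint : ∀ {a b j} → a ≢ b → j ∈ slab-labels a → j ∈ slab-labels b → ⊥
    labels-disjoint {a} {b} {j} a≢b j∈a j∈b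
      with ∈-filter⁻ (fixedIn? (slab a)) {xs = M} j∈a | ∈-filter⁻ (fixedIn? (slab b)) {xs = M} j∈b
    ... | j∈M , fixed-a | _ , fixed-b = n≮n (length M)
      (≤-trans (length<∑length-filter (λ a → fixedIn? (slab a)) M in-some-slab j∈M fixed-a fixed-b a≢b) ∑labels≤)

    labels⊆M : ∀ a → slab-labels a ⊆ M
    labels⊆M a j∈ = proj₁ (∈-filter⁻ (fixedIn? (slab a)) {xs = M} j∈)

    slab-extremal : ∀ a → Extremal (D [ i ≔ a ]) m (slab a) (slab-labels a)
    slab-extremal a = record
      { partition = restrict-partition (partition E) D-free a
      ; codim = slab-codim a
      ; active = slab-active a
      ; tight = slab-tight a
      }

  extremal⇒tree : ∀ m {D P L} → Extremal D m P L → TreeOf D m P L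
  extremal⇒tree zero E = extremal-depth-zero E
  extremal⇒tree (suc m) {D} {P} {L} E = from-common-label (common-label E)
    where
    from-common-label : (∃ λ i → i ∈ L × (∀ {c} → c ∈ P → Fixed c i)) → TreeOf D (suc m) P L
    from-common-label (i , i∈L , fixed-at-i) = record
      { labels = i ∷ ⋃ sublabels
      ; labelling = record
        { unique = All.tabulate (λ j∈ i≡j → proj₂ (∈-delete⁻ _≟_ L (in-M j∈)) (sym i≡j))
                   ∷ Unique-⋃ sublabels (unique ∘ labelling ∘ sub)
                       (λ a≢b j∈a j∈b → labels-disjoint a≢b (labels⊆ (sub _) j∈a) (labels⊆ (sub _) j∈b))
        ; sized = cong suc (trans (length-⋃ sublabels) (trans (∑-cong (sized ∘ labelling ∘ sub)) (∑-const q (size m))))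
        ; free-at = λ { (here refl) → D-free ; (there j∈) → free (active E) (in-L j∈) }
        }
      ; labels⊆ = λ { (here refl) → i∈L ; (there j∈) → in-L j∈ }
      ; ↭-tree = ↭-trans P↭slabs (↭-trans (⋃-↭ (↭-tree ∘ sub)) (↭-reflexive (sym tree-split)))
      }
      where
      open Slabs E i∈L fixed-at-i
      sub : ∀ a → TreeOf (D [ i ≔ a ]) m (slab a) (slab-labels a)
      sub a = extremal⇒tree m (slab-extremal a)
      sublabels : Fin q → List (Fin n)
      sublabels a = labels (sub a)
      in-M : ∀ {j} → j ∈ ⋃ sublabels → j ∈ M
      in-M j∈ with ∈-⋃⁻ sublabels j∈
      ... | a , j∈ₐ = labels⊆M a (labels⊆ (sub a) j∈ₐ)
      in-L : ∀ {j} → j ∈ ⋃ sublabels → j ∈ L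
      in-L = proj₁ ∘ ∈-delete⁻ _≟_ L ∘ in-M
      tree-split : tree D (suc m) (i ∷ ⋃ sublabels) ≡ ⋃ λ a → tree (D [ i ≔ a ]) m (sublabels a)
      tree-split = ⋃-cong λ a → cong (tree (D [ i ≔ a ]) m) (chunk-⋃ q (size m) sublabels (sized ∘ labelling ∘ sub) a)

-- Counting A-primitive partitions

module Enumeration (r m : ℕ) where

  q h : ℕ
  q = suc (suc r)
  h = treeSize q m

  whole : ∀ n → Cube q n
  whole n = replicate n nothing

  dim-whole : ∀ n → dim (whole n) ≡ n
  dim-whole zero = refl
  dim-whole (suc n) = cong suc (dim-whole n)

  module _ {n : ℕ} where
    open Subcubes r n
    open LowerBound r n

    partition-of-whole : ∀ {P : List C} → IsPartition P → IsPartitionOf (whole n) P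
    partition-of-whole (pairwise-disjoint , covering) = record
      { disjoint = pairwise-disjoint
      ; inside = λ _ → inside-at λ i → inj₁ (lookup-replicate i nothing)
      ; covers = λ x _ → covering x
      }

    active-whole : ∀ {P : List C} → APrimitive P → Active (whole n) P (allFin n)
    active-whole A-primitive = record
      { distinct = Unique.allFin⁺ n
      ; free = λ {j} _ → lookup-replicate j nothing
      ; fixedIn = λ {j} _ → A-primitive j
      }

  no-partition-above : ∀ n → h < n → ∀ (P : List (Cube q n)) → APrimPartition q m n P → ⊥
  no-partition-above n h<n P (P-part , A-primitive , len , _) = <⇒≱ h<n (*-cancelˡ-≤ (suc r) (+-cancelʳ-≤ 1 _ _ (begin
    suc r * n + 1                  ≡⟨ cong (λ l → suc r * l + 1) (length-allFin n) ⟨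
    suc r * length (allFin n) + 1  ≤⟨ LowerBound.bound r n (partition-of-whole P-part) (active-whole A-primitive) ⟩
    length P                       ≡⟨ len ⟩
    q ^ m                          ≡⟨ treeSize-formula (suc r) m ⟨
    suc r * h + 1                  ∎)))
    where open ≤-Reasoning

  open Subcubes r h using (disjoint; covers)
  open Trees r h
  open ExtremalStructure r h using (Extremal; extremal⇒tree)

  coordinates : Vec (Fin h) h
  coordinates = Vec.allFin h

  coordinates-injective : Injective _≡_ _≡_ (lookup coordinates)
  coordinates-injective eq = trans (sym (Vec.lookup-allFin _)) (trans eq (Vec.lookup-allFin _))

  enumeration : Fin (h !) → List (Cube q h)
  enumeration k = tree (whole h) m (arrangement k coordinates)

  labelling : ∀ k → Labelling (whole h) m (arrangement k coordinates)
  labelling k = record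
    { unique = Unique-arrangement k coordinates coordinates-injective
    ; sized = length-arrangement k coordinates
    ; free-at = λ {j} _ → lookup-replicate j nothing
    }

  enumeration-APrimPartition : ∀ k → APrimPartition q m h (enumeration k)
  enumeration-APrimPartition k =
    (disjoint (tree-partition (labelling k)) , λ x → covers (tree-partition (labelling k)) x λ i → inj₁ (lookup-replicate i nothing)) ,
    (λ i → tree-fixes-labels (labelling k)
             (subst (_∈ arrangement k coordinates) (Vec.lookup-allFin i) (∈-arrangement⁺ k coordinates i))) ,
    length-tree (labelling k) ,
    λ c c∈ → trans (dim-tree (labelling k) c∈) (dim-whole h)

  enumeration-injective : ∀ k k′ → enumeration k ↭ enumeration k′ → k ≡ k′
  enumeration-injective k k′ p =
    arrangement-injective coordinates coordinates-injective k k′ (tree-injective (labelling k) (labelling k′) p)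

  enumeration-complete : ∀ P → APrimPartition q m h P → ∃ λ k → P ↭ enumeration k
  enumeration-complete P (P-part , A-primitive , len , dims) with extremal⇒tree m extremal
    where
    extremal : Extremal (whole h) m P (allFin h)
    extremal = record
      { partition = partition-of-whole P-part
      ; codim = λ c∈ → trans (dims _ c∈) (sym (dim-whole h))
      ; active = active-whole A-primitive
      ; tight = begin
        suc r * length (allFin h) + 1  ≡⟨ cong (λ l → suc r * l + 1) (length-allFin h) ⟩
        suc r * h + 1                  ≡⟨ treeSize-formula (suc r) m ⟩
        q ^ m                          ≡⟨ len ⟨
        length P                       ∎
      }
      where open ≡-Reasoning
  ... | record { labels = ℓ ; labelling = ℓ-labelling ; ↭-tree = P↭tree } with
        arrangement-surjective coordinates ℓ (unique ℓ-labelling) (sized ℓ-labelling) (λ {j} _ → j , Vec.lookup-allFin j)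
  ...   | k , refl = k , P↭tree

  h-minimal : ∀ N′ → (∀ n → N′ < n → ∀ (P : List (Cube q n)) → APrimPartition q m n P → ⊥) → h ≤ N′
  h-minimal N′ none-above with h ≤? N′
  ... | yes h≤N′ = h≤N′
  ... | no h≰N′ = ⊥-elim (none-above h (≰⇒> h≰N′) (enumeration k₀) (enumeration-APrimPartition k₀))
    where
    k₀ : Fin (h !)
    k₀ = fromℕ< (1≤n! h)

theorem7 : ∀ (q m : ℕ) → 2 ≤ q → 1 ≤ m →
    IsNcoord q m (hOf q m)
    × (Σ (Fin (hOf q m !) → List (Cube q (hOf q m))) λ e →
        (∀ i → APrimPartition q m (hOf q m) (e i))
        × (∀ i j → e i ↭ e j → i ≡ j)
        × (∀ P → APrimPartition q m (hOf q m) P → ∃ λ i → P ↭ e i))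
theorem7 (suc (suc r)) m (s≤s (s≤s z≤n)) _ rewrite hOf≡treeSize r m =
  (no-partition-above , h-minimal) , enumeration , enumeration-APrimPartition , enumeration-injective , enumeration-complete
  where open Enumeration r m
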